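{- Let $P_1,P_2,R$ be extended logic programs with $R$ tau-free. If $P_2\vdash_{N_2}R$, then $P_1\oplus_1P_2\equiv P_1\oplus_1(P_2\cup R)$, i.e. the update answer sets of $(P_1,P_2)$ and of $(P_1,P_2\cup R)$ coincide.
   Context: A literal is an atom $a$ or $\sim a$ ($\sim$ strong negation); $\sim L$ is the complement of $L$; $Lit_{\mathcal{A}}$ is the set of literals over $\mathcal{A}$; $\lnot F$ is $F\rightarrow\bot$. An extended logic program (ELP) is a finite set of rules $r$: $L\leftarrow B_1,\dots,B_m,\lnot B_{m+1},\dots,\lnot B_n$ ($L,B_i$ literals, $\top$ or $\bot$), head $H(r)=L$, body $B(r)$; constraint if $H(r)=\bot$. A program is tau-free if it contains no rule of the form $l\leftarrow l,\alpha$ ($l$ a literal, $\alpha$ possibly empty). $\mathrm{N}_2$ is intuitionistic propositional logic plus Nelson's axioms ($\sim(\alpha\rightarrow\beta)\leftrightarrow\alpha\wedge\sim\beta$, $\sim(\alpha\wedge\beta)\leftrightarrow\sim\alpha\vee\sim\beta$, $\sim(\alpha\vee\beta)\leftrightarrow\sim\alpha\wedge\sim\beta$, $\alpha\leftrightarrow\sim\sim\alpha$, $\sim\lnot\alpha\leftrightarrow\alpha$, $\sim a\rightarrow\lnot a$) and $\alpha\vee(\alpha\rightarrow\beta)\vee\lnot\beta$; $T\vdash_{N_2}R$ means $T$ derives every formula of $R$. For a finite set of formulas $T$ over atoms $\mathcal{B}$, a consistent $M\subseteq Lit_{\mathcal{B}}$ is an answer set iff $T\cup\{\lnot l: l\in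 Lit_{\mathcal{B}}\setminus M\}\cup\{\lnot\lnot l:l\in M\}$ is $\mathrm{N}_2$-consistent and $\mathrm{N}_2$-derives each element of $M$. Operator $\oplus_1$ for ELPs $Q_1,Q_2$ with $\mathcal{A}$ the atoms occurring in them: add fresh atoms $rej(r)$ for each rule $r$ (rules of $Q_1,Q_2$ named distinctly) and $A_1,A_2$ for $A\in\mathcal{A}$; $L_i$ replaces the atom $A$ of $L$ by $A_i$. $Q_1\oplus_1Q_2$ consists of: (i) all constraints of $Q_1\cup Q_2$; (ii) for each non-constraint $r\in Q_1$ with $H(r)=L$: $L_1\leftarrow B(r),\lnot rej(r)$ and $rej(r)\leftarrow B(r),\sim L_2$; (iii) for each non-constraint $r\in Q_2$ with $H(r)=L$: $L_2\leftarrow B(r)$; (iv) for each literal $L$ occurring in $Q_1\cup Q_2$: $L_1\leftarrow L_2$ and $L\leftarrow L_1$. The update answer sets of $(Q_1,Q_2)$ are the sets $S'\cap Lit_{\mathcal{A}}$ for $S'$ an answer set of $Q_1\oplus_1Q_2$. -}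

module Defs where

open import Data.Nat using (ℕ)
open import Data.List using (List; []; _∷_; _++_; concatMap; map; foldr)
open import Data.List.Membership.Propositional using (_∈_)
open import Data.Product using (Σ; ∃; _×_; _,_)
open import Data.Sum using (_⊎_)
open import Relation.Nullary using (¬_)
open import Relation.Binary.PropositionalEquality using (_≡_)

infixr 4 _⇒ᶠ_
infixr 5 _∨ᶠ_
infixr 6 _∧ᶠ_
infix  7 ∼ᶠ_

data Form (A : Set) : Set where
  atomᶠ : A → Form A
  ⊥ᶠ ⊤ᶠ : Form A
  _∧ᶠ_ _∨ᶠ_ _⇒ᶠ_ : Form A → Form A → Form A
  ∼ᶠ_ : Form A → Form A

module _ {A : Set} where

  infix  3 _⇔ᶠ_
  infix  7 ¬ᶠ_

  ¬ᶠ_ : Form A → Form A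
  ¬ᶠ F = F ⇒ᶠ ⊥ᶠ

  _⇔ᶠ_ : Form A → Form A → Form A
  F ⇔ᶠ G = (F ⇒ᶠ G) ∧ᶠ (G ⇒ᶠ F)

  data Axiom : Form A → Set where
    axK   : ∀ α β → Axiom (α ⇒ᶠ β ⇒ᶠ α)
    axS   : ∀ α β γ → Axiom ((α ⇒ᶠ β ⇒ᶠ γ) ⇒ᶠ (α ⇒ᶠ β) ⇒ᶠ α ⇒ᶠ γ)
    ax∧I  : ∀ α β → Axiom (α ⇒ᶠ β ⇒ᶠ α ∧ᶠ β)
    ax∧E₁ : ∀ α β → Axiom (α ∧ᶠ β ⇒ᶠ α)
    ax∧E₂ : ∀ α β → Axiom (α ∧ᶠ β ⇒ᶠ β)
    ax∨I₁ : ∀ α β → Axiom (α ⇒ᶠ α ∨ᶠ β)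
    ax∨I₂ : ∀ α β → Axiom (β ⇒ᶠ α ∨ᶠ β)
    ax∨E  : ∀ α β γ → Axiom ((α ⇒ᶠ γ) ⇒ᶠ (β ⇒ᶠ γ) ⇒ᶠ α ∨ᶠ β ⇒ᶠ γ)
    ax⊥E  : ∀ α → Axiom (⊥ᶠ ⇒ᶠ α)
    ax⊤   : Axiom ⊤ᶠ
    axN⇒  : ∀ α β → Axiom (∼ᶠ (α ⇒ᶠ β) ⇔ᶠ α ∧ᶠ ∼ᶠ β)
    axN∧  : ∀ α β → Axiom (∼ᶠ (α ∧ᶠ β) ⇔ᶠ ∼ᶠ α ∨ᶠ ∼ᶠ β)
    axN∨  : ∀ α β → Axiom (∼ᶠ (α ∨ᶠ β) ⇔ᶠ ∼ᶠ α ∧ᶠ ∼ᶠ β)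
    axN∼∼ : ∀ α → Axiom (α ⇔ᶠ ∼ᶠ ∼ᶠ α)
    axN∼¬ : ∀ α → Axiom (∼ᶠ (¬ᶠ α) ⇔ᶠ α)
    axNat : ∀ a → Axiom (∼ᶠ atomᶠ a ⇒ᶠ ¬ᶠ atomᶠ a)
    axN2  : ∀ α β → Axiom (α ∨ᶠ (α ⇒ᶠ β) ∨ᶠ ¬ᶠ β)

  Theory : Set₁
  Theory = Form A → Set

  infix 2 _⊢_
  data _⊢_ (T : Theory) : Form A → Set where
    hyp : ∀ {φ} → T φ → T ⊢ φ
    ax  : ∀ {φ} → Axiom φ → T ⊢ φ
    mp  : ∀ {φ ψ} → T ⊢ (φ ⇒ᶠ ψ) → T ⊢ φ → T ⊢ ψ

  N2-consistent : Theory → Set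
  N2-consistent T = ¬ (T ⊢ ⊥ᶠ)

data Lit (A : Set) : Set where
  +ℓ : A → Lit A
  -ℓ : A → Lit A

data Elem (A : Set) : Set where
  lit : Lit A → Elem A
  top bot : Elem A

data Head (A : Set) : Set where
  hlit : Lit A → Head A
  hbot : Head A

-- L ← B₁,…,Bₘ, ¬Bₘ₊₁,…,¬Bₙ
record Rule (A : Set) : Set where
  constructor rule
  field
    head : Head A
    pos  : List (Elem A)
    neg  : List (Elem A)
open Rule public

Program : Set → Set
Program A = List (Rule A)

module _ {A : Set} where

  atomOf : Lit A → A
  atomOf (+ℓ a) = a
  atomOf (-ℓ a) = a

  compl : Lit A → Lit A
  compl (+ℓ a) = -ℓ a
  compl (-ℓ a) = +ℓ a

  litF : Lit A → Form A
  litF (+ℓ a) = atomᶠ a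
  litF (-ℓ a) = ∼ᶠ atomᶠ a

  elemF : Elem A → Form A
  elemF (lit L) = litF L
  elemF top = ⊤ᶠ
  elemF bot = ⊥ᶠ

  headF : Head A → Form A
  headF (hlit L) = litF L
  headF hbot = ⊥ᶠ

  headElem : Head A → Elem A
  headElem (hlit L) = lit L
  headElem hbot = bot

  bodyF : Rule A → Form A
  bodyF r = foldr _∧ᶠ_ ⊤ᶠ (map elemF (pos r) ++ map (λ e → ¬ᶠ elemF e) (neg r))

  ruleF : Rule A → Form A
  ruleF r = bodyF r ⇒ᶠ headF (head r)

  progT : Program A → Theory
  progT P φ = Σ (Rule A) λ r → r ∈ P × φ ≡ ruleF r

  _⊢Prog_ : Program A → Program A → Set
  P ⊢Prog R = ∀ r → r ∈ R → progT P ⊢ ruleF r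

  TauFree : Program A → Set
  TauFree P = ∀ r L → r ∈ P → head r ≡ hlit L → ¬ (lit L ∈ pos r)

  elemsOf : Rule A → List (Elem A)
  elemsOf r = headElem (head r) ∷ (pos r ++ neg r)

  LitOccurs : Lit A → Program A → Set
  LitOccurs L P = Σ (Rule A) λ r → r ∈ P × lit L ∈ elemsOf r

  AtomOccurs : A → Program A → Set
  AtomOccurs a P = Σ (Lit A) λ L → LitOccurs L P × atomOf L ≡ a

  ConsistentLits : (Lit A → Set) → Set
  ConsistentLits M = ∀ a → M (+ℓ a) → M (-ℓ a) → Data.Empty.⊥
    where import Data.Empty

  answerTheory : Program A → (Lit A → Set) → Theory
  answerTheory P M φ =
      progT P φ
    ⊎ (Σ (Lit A) λ l → AtomOccurs (atomOf l) P × ¬ M l × φ ≡ ¬ᶠ litF l)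
    ⊎ (Σ (Lit A) λ l → M l × φ ≡ ¬ᶠ ¬ᶠ litF l)

  AnswerSet : Program A → (Lit A → Set) → Set
  AnswerSet P M =
      (∀ l → M l → AtomOccurs (atomOf l) P)
    × ConsistentLits M
    × N2-consistent (answerTheory P M)
    × (∀ l → M l → answerTheory P M ⊢ litF l)

-- The update operator ⊕₁.  Original atoms are natural numbers; the
-- extended signature adds fresh copies A₁, A₂ and atoms rej(r).

BRule : Set
BRule = Rule ℕ

data XAtom : Set where
  orig : ℕ → XAtom
  one  : ℕ → XAtom
  two  : ℕ → XAtom
  rej  : BRule → XAtom

mapLit : {A B : Set} → (A → B) → Lit A → Lit B
mapLit f (+ℓ a) = +ℓ (f a)
mapLit f (-ℓ a) = -ℓ (f a)

mapElem : {A B : Set} → (A → B) → Elem A → Elem B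
mapElem f (lit L) = lit (mapLit f L)
mapElem f top = top
mapElem f bot = bot

mapHead : {A B : Set} → (A → B) → Head A → Head B
mapHead f (hlit L) = hlit (mapLit f L)
mapHead f hbot = hbot

embed : BRule → Rule XAtom
embed r = rule (mapHead orig (head r)) (map (mapElem orig) (pos r)) (map (mapElem orig) (neg r))

constraintPart : BRule → Head ℕ → List (Rule XAtom)
constraintPart r hbot = embed r ∷ []
constraintPart r (hlit _) = []

q1Part : BRule → Head ℕ → List (Rule XAtom)
q1Part r hbot = []
q1Part r (hlit L) =
    rule (hlit (mapLit one L)) B⁺ (lit (+ℓ (rej r)) ∷ B⁻)
  ∷ rule (hlit (+ℓ (rej r))) (lit (compl (mapLit two L)) ∷ B⁺) B⁻
  ∷ []
  where
  B⁺ = map (mapElem orig) (pos r)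
  B⁻ = map (mapElem orig) (neg r)

q2Part : BRule → Head ℕ → List (Rule XAtom)
q2Part r hbot = []
q2Part r (hlit L) =
  rule (hlit (mapLit two L)) (map (mapElem orig) (pos r)) (map (mapElem orig) (neg r)) ∷ []

litsOfElems : List (Elem ℕ) → List (Lit ℕ)
litsOfElems [] = []
litsOfElems (lit L ∷ es) = L ∷ litsOfElems es
litsOfElems (top ∷ es) = litsOfElems es
litsOfElems (bot ∷ es) = litsOfElems es

litsOf : BRule → List (Lit ℕ)
litsOf r = litsOfElems (elemsOf r)

inhPart : Lit ℕ → List (Rule XAtom)
inhPart L =
    rule (hlit (mapLit one L)) (lit (mapLit two L) ∷ []) []
  ∷ rule (hlit (mapLit orig L)) (lit (mapLit one L) ∷ []) []
  ∷ []

_⊕₁_ : Program ℕ → Program ℕ → Program XAtom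
Q₁ ⊕₁ Q₂ =
     concatMap (λ r → constraintPart r (head r)) (Q₁ ++ Q₂)
  ++ concatMap (λ r → q1Part r (head r)) Q₁
  ++ concatMap (λ r → q2Part r (head r)) Q₂
  ++ concatMap inhPart (concatMap litsOf (Q₁ ++ Q₂))

UpdateAnswerSet : Program ℕ → Program ℕ → (Lit ℕ → Set) → Set₁
UpdateAnswerSet Q₁ Q₂ M =
  Σ (Lit XAtom → Set) λ S' →
      AnswerSet (Q₁ ⊕₁ Q₂) S'
    × (∀ l → (M l → S' (mapLit orig l) × AtomOccurs (atomOf l) (Q₁ ++ Q₂))
           × (S' (mapLit orig l) × AtomOccurs (atomOf l) (Q₁ ++ Q₂) → M l))

{-# OPTIONS --safe #-}
-- The rules that P₂ ∪ R adds to P₁ ⊕₁ (P₂ ∪ R) are already derivable in N2 from P₁ ⊕₁ P₂, once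
-- atoms occurring in neither program are erased (replaced by ⊥). Hence the answer theories of the
-- two update programs derive the same formulas and have the same answer sets; copies of literals
-- over such fresh atoms are never in an answer set, since no rule supports them.
--
-- The crucial derivation is B(r) → L₂ for a rule L ← B(r) of R. Split on ¬ l ∨ ¬¬ l (an instance
-- of the N2 axiom) for every literal l of P₂ ∪ R. In a branch that is not refuted outright, the
-- guessed values σ form a consistent model of P₂ satisfying B(r); the least model D of the reduct
-- P₂^σ containing the positive body of r makes (D, σ) a here-and-there model of P₂ and B(r). By
-- soundness of N2 for these models (checked schema by schema on the nine persistent truth-value
-- profiles) and P₂ ⊢ r, L lies in D. As R is tau-free, L is not in the positive body of r, so a rule
-- L ← B′ of P₂ produced it, and its copy L₂ ← B′ in P₁ ⊕₁ P₂ derives L₂ along the construction of D.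
module Submission where

open import Defs
open import Data.Bool using (Bool; true; false; _∧_; _∨_; not; if_then_else_)
open import Data.Bool.ListAction using (all; any)
open import Data.Bool.Properties using (∧-zeroʳ; ∧-identityʳ; ¬-not; not-injective)
open import Data.Empty using (⊥; ⊥-elim)
open import Data.Fin using (Fin; zero; suc)
open import Data.List using (List; []; _∷_; _++_; [_]; map; foldr; concatMap; length)
import Data.List.Properties as List
open import Data.List.Membership.Propositional using (_∈_; find; lose)
open import Data.List.Membership.Propositional.Properties
  using (∈-++⁺ˡ; ∈-++⁺ʳ; ∈-++⁻; ∈-map⁺; ∈-map⁻; ∈-concatMap⁺; ∈-concatMap⁻)
open import Data.List.Relation.Unary.All as All using (All; []; _∷_)
import Data.List.Relation.Unary.All.Properties as All
open import Data.List.Relation.Unary.Any using (here; there; any?)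
open import Data.Nat using (ℕ; zero; suc; _≤_; z≤n; s≤s)
import Data.Nat.Properties as ℕ
open import Data.Product using (∃; _×_; _,_; proj₁; proj₂)
open import Data.Sum using (_⊎_; inj₁; inj₂)
open import Data.Unit using (⊤; tt)
open import Data.Vec using (lookup) renaming ([] to []ᵛ; _∷_ to _∷ᵛ_)
import Data.Vec.Functional as Vector
open import Function using (_∘_)
open import Relation.Binary.Definitions using (DecidableEquality)
open import Relation.Binary.PropositionalEquality hiding ([_])
open import Relation.Nullary using (¬_; Dec; yes; no; does; contradiction)
import Relation.Nullary.Decidable as Dec

infixr 4 _⇒ᵇ_
_⇒ᵇ_ : Bool → Bool → Bool
a ⇒ᵇ b = not a ∨ b

false≢true : false ≢ true
false≢true ()

∧-true⁻ : ∀ {a b} → a ∧ b ≡ true → a ≡ true × b ≡ true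
∧-true⁻ {true} {true} _ = refl , refl

∧-true⁺ : ∀ {a b} → a ≡ true → b ≡ true → a ∧ b ≡ true
∧-true⁺ refl refl = refl

∨-true⁻ : ∀ {a b} → a ∨ b ≡ true → a ≡ true ⊎ b ≡ true
∨-true⁻ {true}  _ = inj₁ refl
∨-true⁻ {false} e = inj₂ e

∨-trueˡ : ∀ {a b} → a ≡ true → a ∨ b ≡ true
∨-trueˡ refl = refl

∨-trueʳ : ∀ {a b} → b ≡ true → a ∨ b ≡ true
∨-trueʳ {true}  _ = refl
∨-trueʳ {false} e = e

⇒ᵇ-elim : ∀ {a b} → (a ⇒ᵇ b) ≡ true → a ≡ true → b ≡ true
⇒ᵇ-elim {true} e refl = e

∧-false⁻ : ∀ {a b} → a ∧ b ≡ false → a ≡ false ⊎ b ≡ false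
∧-false⁻ {false} _ = inj₁ refl
∧-false⁻ {true}  e = inj₂ e

⇒ᵇ-false⁻ : ∀ {a b} → (a ⇒ᵇ b) ≡ false → a ≡ true × b ≡ false
⇒ᵇ-false⁻ {true} {false} _ = refl , refl

⇒ᵇ-intro : ∀ {a b} → (a ≡ true → b ≡ true) → (a ⇒ᵇ b) ≡ true
⇒ᵇ-intro {true}  f = f refl
⇒ᵇ-intro {false} f = refl

module _ {X : Set} where

  all-true⁻ : ∀ (f : X → Bool) xs → all f xs ≡ true → All (λ x → f x ≡ true) xs
  all-true⁻ f []       _ = []
  all-true⁻ f (y ∷ xs) e = proj₁ (∧-true⁻ {f y} e) ∷ all-true⁻ f xs (proj₂ (∧-true⁻ {f y} e))

  all-true⁺ : ∀ {f : X → Bool} xs → All (λ x → f x ≡ true) xs → all f xs ≡ true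
  all-true⁺ []       []       = refl
  all-true⁺ (_ ∷ xs) (e ∷ es) = ∧-true⁺ e (all-true⁺ xs es)

  all-false⁻ : ∀ {f : X → Bool} xs → all f xs ≡ false → ∃ λ x → x ∈ xs × f x ≡ false
  all-false⁻ {f} (x ∷ xs) e with f x in fx
  ... | false = x , here refl , fx
  ... | true with all-false⁻ xs e
  ...   | y , m , fy = y , there m , fy

  any-true⁺ : ∀ {f : X → Bool} {xs x} → x ∈ xs → f x ≡ true → any f xs ≡ true
  any-true⁺ (here refl) e = ∨-trueˡ e
  any-true⁺ {f} {y ∷ xs} (there m) e = ∨-trueʳ {f y} (any-true⁺ m e)

  any-true⁻ : ∀ {f : X → Bool} xs → any f xs ≡ true → ∃ λ x → x ∈ xs × f x ≡ true
  any-true⁻ {f} (x ∷ xs) e with ∨-true⁻ {f x} e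
  ... | inj₁ fx = x , here refl , fx
  ... | inj₂ r with any-true⁻ xs r
  ...   | y , m , fy = y , there m , fy

does-true⁻ : ∀ {P : Set} (d : Dec P) → does d ≡ true → P
does-true⁻ (yes p) _ = p

module _ {X : Set} where

  countᵇ : (X → Bool) → List X → ℕ
  countᵇ V []       = 0
  countᵇ V (x ∷ xs) = if V x then suc (countᵇ V xs) else countᵇ V xs

  countᵇ-≤-length : ∀ V xs → countᵇ V xs ≤ length xs
  countᵇ-≤-length V []       = z≤n
  countᵇ-≤-length V (x ∷ xs) with V x
  ... | true  = s≤s (countᵇ-≤-length V xs)
  ... | false = ℕ.m≤n⇒m≤1+n (countᵇ-≤-length V xs)

  countᵇ-mono : ∀ {V V′} xs → (∀ x → V x ≡ true → V′ x ≡ true) → countᵇ V xs ≤ countᵇ V′ xs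
  countᵇ-mono []       _ = z≤n
  countᵇ-mono {V} {V′} (x ∷ xs) V⊆V′ with V x in e | V′ x in e′
  ... | true  | true  = s≤s (countᵇ-mono xs V⊆V′)
  ... | true  | false = contradiction (trans (sym e′) (V⊆V′ x e)) false≢true
  ... | false | true  = ℕ.m≤n⇒m≤1+n (countᵇ-mono xs V⊆V′)
  ... | false | false = countᵇ-mono xs V⊆V′

  countᵇ-strict : ∀ {V V′ x} xs → (∀ y → V y ≡ true → V′ y ≡ true) → x ∈ xs → V x ≡ false → V′ x ≡ true →
                  suc (countᵇ V xs) ≤ countᵇ V′ xs
  countᵇ-strict {V} {V′} (y ∷ xs) V⊆V′ (here refl) f t rewrite f | t = s≤s (countᵇ-mono xs V⊆V′)
  countᵇ-strict {V} {V′} (y ∷ xs) V⊆V′ (there m) f t with V y in e | V′ y in e′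
  ... | true  | true  = s≤s (countᵇ-strict xs V⊆V′ m f t)
  ... | true  | false = contradiction (trans (sym e′) (V⊆V′ y e)) false≢true
  ... | false | true  = ℕ.m≤n⇒m≤1+n (countᵇ-strict xs V⊆V′ m f t)
  ... | false | false = countᵇ-strict xs V⊆V′ m f t

  -- Every step before closure adds an element of Λ, so there are at most |Λ| of them.
  chain-closes : (Λ : List X) (D : ℕ → X → Bool) (Closed : ℕ → Set) →
    (∀ k x → D k x ≡ true → D (suc k) x ≡ true) → (∀ k → Closed k → Closed (suc k)) →
    (∀ k → Closed k ⊎ ∃ λ x → x ∈ Λ × D k x ≡ false × D (suc k) x ≡ true) →
    Closed (suc (length Λ))
  chain-closes Λ D Closed grows stays progress with closed-or-large (suc (length Λ))
    where
    closed-or-large : ∀ k → Closed k ⊎ k ≤ countᵇ (D k) Λ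
    closed-or-large zero = inj₂ z≤n
    closed-or-large (suc k) with progress k | closed-or-large k
    ... | inj₁ c                  | _       = inj₁ (stays k c)
    ... | inj₂ _                  | inj₁ c  = inj₁ (stays k c)
    ... | inj₂ (x , x∈Λ , f , t)  | inj₂ k≤ = inj₂ (ℕ.≤-trans (s≤s k≤) (countᵇ-strict Λ (grows k) x∈Λ f t))
  ... | inj₁ c     = c
  ... | inj₂ large = contradiction (ℕ.≤-trans large (countᵇ-≤-length _ Λ)) ℕ.1+n≰n

module _ {A : Set} where

  infixl 3 _,,_
  _,,_ : Theory {A} → Form A → Theory {A}
  (Γ ,, φ) ψ = Γ ψ ⊎ ψ ≡ φ

  ⊢-mono : ∀ {Γ Δ : Theory {A}} {φ} → (∀ {ψ} → Γ ψ → Δ ψ) → Γ ⊢ φ → Δ ⊢ φ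
  ⊢-mono f (hyp h)  = hyp (f h)
  ⊢-mono f (ax a)   = ax a
  ⊢-mono f (mp d e) = mp (⊢-mono f d) (⊢-mono f e)

  module _ {Γ : Theory {A}} where

    ⊢-id : ∀ {φ} → Γ ⊢ φ ⇒ᶠ φ
    ⊢-id {φ} = mp (mp (ax (axS φ (φ ⇒ᶠ φ) φ)) (ax (axK φ (φ ⇒ᶠ φ)))) (ax (axK φ φ))

    ⊢-const : ∀ {φ ψ} → Γ ⊢ ψ → Γ ⊢ φ ⇒ᶠ ψ
    ⊢-const d = mp (ax (axK _ _)) d

    ⊢-S : ∀ {φ ψ χ} → Γ ⊢ φ ⇒ᶠ ψ ⇒ᶠ χ → Γ ⊢ φ ⇒ᶠ ψ → Γ ⊢ φ ⇒ᶠ χ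
    ⊢-S d e = mp (mp (ax (axS _ _ _)) d) e

    ∧I : ∀ {φ ψ} → Γ ⊢ φ → Γ ⊢ ψ → Γ ⊢ φ ∧ᶠ ψ
    ∧I d e = mp (mp (ax (ax∧I _ _)) d) e

    ∧E₁ : ∀ {φ ψ} → Γ ⊢ φ ∧ᶠ ψ → Γ ⊢ φ
    ∧E₁ d = mp (ax (ax∧E₁ _ _)) d

    ∧E₂ : ∀ {φ ψ} → Γ ⊢ φ ∧ᶠ ψ → Γ ⊢ ψ
    ∧E₂ d = mp (ax (ax∧E₂ _ _)) d

    ∨I₁ : ∀ {φ ψ} → Γ ⊢ φ → Γ ⊢ φ ∨ᶠ ψ
    ∨I₁ d = mp (ax (ax∨I₁ _ _)) d

    ∨I₂ : ∀ {φ ψ} → Γ ⊢ ψ → Γ ⊢ φ ∨ᶠ ψ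
    ∨I₂ d = mp (ax (ax∨I₂ _ _)) d

    ∨E : ∀ {φ ψ χ} → Γ ⊢ φ ⇒ᶠ χ → Γ ⊢ ψ ⇒ᶠ χ → Γ ⊢ φ ∨ᶠ ψ → Γ ⊢ χ
    ∨E d e f = mp (mp (mp (ax (ax∨E _ _ _)) d) e) f

    ⊥E : ∀ {φ} → Γ ⊢ ⊥ᶠ → Γ ⊢ φ
    ⊥E d = mp (ax (ax⊥E _)) d

    ⇔-refl : ∀ {φ} → Γ ⊢ φ ⇔ᶠ φ
    ⇔-refl = ∧I ⊢-id ⊢-id

  deduction : ∀ {Γ : Theory {A}} {φ ψ} → (Γ ,, φ) ⊢ ψ → Γ ⊢ φ ⇒ᶠ ψ
  deduction (hyp (inj₁ h))    = ⊢-const (hyp h)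
  deduction (hyp (inj₂ refl)) = ⊢-id
  deduction (ax a)            = ⊢-const (ax a)
  deduction (mp d e)          = ⊢-S (deduction d) (deduction e)

  wk : ∀ {Γ : Theory {A}} {φ ψ} → Γ ⊢ ψ → (Γ ,, φ) ⊢ ψ
  wk = ⊢-mono inj₁

  asm : ∀ {Γ : Theory {A}} {φ} → (Γ ,, φ) ⊢ φ
  asm = hyp (inj₂ refl)

  ¬¬-intro : ∀ {Γ : Theory {A}} {φ} → Γ ⊢ φ → Γ ⊢ ¬ᶠ ¬ᶠ φ
  ¬¬-intro d = deduction (mp asm (wk d))

  -- From the N2 axiom instance  ¬φ ∨ (¬φ → ¬¬φ) ∨ ¬¬¬φ.
  weak-excluded-middle : ∀ {Γ : Theory {A}} {φ} → Γ ⊢ ¬ᶠ φ ∨ᶠ ¬ᶠ ¬ᶠ φ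
  weak-excluded-middle {Γ} {φ} =
    ∨E (deduction (∨I₁ asm)) (deduction (∨E fromImplication fromTripleNegation asm))
       (ax (axN2 (¬ᶠ φ) (¬ᶠ ¬ᶠ φ)))
    where
    Δ : Theory {A}
    Δ = Γ ,, ((¬ᶠ φ ⇒ᶠ ¬ᶠ ¬ᶠ φ) ∨ᶠ ¬ᶠ ¬ᶠ ¬ᶠ φ)
    fromImplication : Δ ⊢ (¬ᶠ φ ⇒ᶠ ¬ᶠ ¬ᶠ φ) ⇒ᶠ (¬ᶠ φ ∨ᶠ ¬ᶠ ¬ᶠ φ)
    fromImplication = deduction (∨I₂ (deduction (mp (mp (wk asm) asm) asm)))
    fromTripleNegation : Δ ⊢ ¬ᶠ ¬ᶠ ¬ᶠ φ ⇒ᶠ (¬ᶠ φ ∨ᶠ ¬ᶠ ¬ᶠ φ)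
    fromTripleNegation = deduction (∨I₁ (deduction (mp (wk asm) (¬¬-intro asm))))

  ¬-or-¬¬ : ∀ {Γ : Theory {A}} {φ ψ} → (Γ ,, ¬ᶠ φ) ⊢ ψ → (Γ ,, ¬ᶠ ¬ᶠ φ) ⊢ ψ → Γ ⊢ ψ
  ¬-or-¬¬ d e = ∨E (deduction d) (deduction e) weak-excluded-middle

  ¬¬-∧ : ∀ {Γ : Theory {A}} {φ ψ} → Γ ⊢ ¬ᶠ ¬ᶠ φ → Γ ⊢ ¬ᶠ ¬ᶠ ψ → Γ ⊢ ¬ᶠ ¬ᶠ (φ ∧ᶠ ψ)
  ¬¬-∧ d e =
    deduction (mp (wk d) (deduction (mp (wk (wk e)) (deduction (mp (wk (wk asm)) (∧I (wk asm) asm))))))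

  ¬¬-coherent : ∀ {Γ : Theory {A}} a → Γ ⊢ ¬ᶠ ¬ᶠ atomᶠ a → Γ ⊢ ¬ᶠ ¬ᶠ ∼ᶠ atomᶠ a → Γ ⊢ ⊥ᶠ
  ¬¬-coherent a d⁺ d⁻ = mp d⁻ (deduction (mp (wk d⁺) (mp (ax (axNat a)) asm)))

  ⋀ : List (Form A) → Form A
  ⋀ = foldr _∧ᶠ_ ⊤ᶠ

  ⋀-intro : ∀ {Γ : Theory {A}} {φs} → All (Γ ⊢_) φs → Γ ⊢ ⋀ φs
  ⋀-intro []       = ax ax⊤
  ⋀-intro (d ∷ ds) = ∧I d (⋀-intro ds)

  ⋀-elim : ∀ {Γ : Theory {A}} {φs φ} → Γ ⊢ ⋀ φs → φ ∈ φs → Γ ⊢ φ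
  ⋀-elim d (here refl) = ∧E₁ d
  ⋀-elim d (there m)   = ⋀-elim (∧E₂ d) m

  ¬¬-⋀ : ∀ {Γ : Theory {A}} {φs} → All (λ φ → Γ ⊢ ¬ᶠ ¬ᶠ φ) φs → Γ ⊢ ¬ᶠ ¬ᶠ ⋀ φs
  ¬¬-⋀ []       = ¬¬-intro (ax ax⊤)
  ¬¬-⋀ (d ∷ ds) = ¬¬-∧ d (¬¬-⋀ ds)

  bodyConjuncts : Rule A → List (Form A)
  bodyConjuncts r = map elemF (pos r) ++ map (¬ᶠ_ ∘ elemF) (neg r)

  pos-conjunct : ∀ {r e} → e ∈ pos r → elemF e ∈ bodyConjuncts r
  pos-conjunct m = ∈-++⁺ˡ (∈-map⁺ elemF m)

  neg-conjunct : ∀ {r e} → e ∈ neg r → ¬ᶠ elemF e ∈ bodyConjuncts r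
  neg-conjunct {r} m = ∈-++⁺ʳ (map elemF (pos r)) (∈-map⁺ (¬ᶠ_ ∘ elemF) m)

  ¬¬-body : ∀ {Γ : Theory {A}} {r} →
            All (λ e → Γ ⊢ ¬ᶠ ¬ᶠ elemF e) (pos r) → All (λ e → Γ ⊢ ¬ᶠ ¬ᶠ ¬ᶠ elemF e) (neg r) →
            Γ ⊢ ¬ᶠ ¬ᶠ bodyF r
  ¬¬-body dp dn = ¬¬-⋀ (All.++⁺ (All.map⁺ dp) (All.map⁺ dn))

  ⊢-body : ∀ {Γ : Theory {A}} {r} →
           All (λ e → Γ ⊢ elemF e) (pos r) → All (λ e → Γ ⊢ ¬ᶠ elemF e) (neg r) → Γ ⊢ bodyF r
  ⊢-body dp dn = ⋀-intro (All.++⁺ (All.map⁺ dp) (All.map⁺ dn))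

-- Translations pushing strong negation to the atoms

module Translation {A B : Set} (f⁺ f⁻ : A → Form B) where

  τ⁺ τ⁻ : Form A → Form B
  τ⁺ (atomᶠ a) = f⁺ a
  τ⁺ ⊥ᶠ        = ⊥ᶠ
  τ⁺ ⊤ᶠ        = ⊤ᶠ
  τ⁺ (φ ∧ᶠ ψ)  = τ⁺ φ ∧ᶠ τ⁺ ψ
  τ⁺ (φ ∨ᶠ ψ)  = τ⁺ φ ∨ᶠ τ⁺ ψ
  τ⁺ (φ ⇒ᶠ ψ)  = τ⁺ φ ⇒ᶠ τ⁺ ψ
  τ⁺ (∼ᶠ φ)    = τ⁻ φ
  τ⁻ (atomᶠ a) = f⁻ a
  τ⁻ ⊥ᶠ        = ⊤ᶠ
  τ⁻ ⊤ᶠ        = ∼ᶠ ⊤ᶠ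
  τ⁻ (φ ∧ᶠ ψ)  = τ⁻ φ ∨ᶠ τ⁻ ψ
  τ⁻ (φ ∨ᶠ ψ)  = τ⁻ φ ∧ᶠ τ⁻ ψ
  τ⁻ (φ ⇒ᶠ ψ)  = τ⁺ φ ∧ᶠ τ⁻ ψ
  τ⁻ (∼ᶠ φ)    = τ⁺ φ

  module _ (f⁻⇒¬f⁺ : ∀ {Γ : Theory {B}} a → Γ ⊢ f⁻ a ⇒ᶠ ¬ᶠ f⁺ a) where

    translate-axiom : ∀ {Γ : Theory {B}} {φ} → Axiom φ → Γ ⊢ τ⁺ φ
    translate-axiom (axK α β)     = ax (axK _ _)
    translate-axiom (axS α β γ)   = ax (axS _ _ _)
    translate-axiom (ax∧I α β)    = ax (ax∧I _ _)
    translate-axiom (ax∧E₁ α β)   = ax (ax∧E₁ _ _)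
    translate-axiom (ax∧E₂ α β)   = ax (ax∧E₂ _ _)
    translate-axiom (ax∨I₁ α β)   = ax (ax∨I₁ _ _)
    translate-axiom (ax∨I₂ α β)   = ax (ax∨I₂ _ _)
    translate-axiom (ax∨E α β γ)  = ax (ax∨E _ _ _)
    translate-axiom (ax⊥E α)      = ax (ax⊥E _)
    translate-axiom ax⊤           = ax ax⊤
    translate-axiom (axN⇒ α β)    = ⇔-refl
    translate-axiom (axN∧ α β)    = ⇔-refl
    translate-axiom (axN∨ α β)    = ⇔-refl
    translate-axiom (axN∼∼ α)     = ⇔-refl
    translate-axiom (axN∼¬ α)     = ∧I (ax (ax∧E₁ _ _)) (deduction (∧I asm (ax ax⊤)))
    translate-axiom (axNat a)     = f⁻⇒¬f⁺ a
    translate-axiom (axN2 α β)    = ax (axN2 _ _)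

    translate : ∀ {Γ : Theory {A}} {Δ : Theory {B}} {φ} →
                (∀ {ψ} → Γ ψ → Δ ⊢ τ⁺ ψ) → Γ ⊢ φ → Δ ⊢ τ⁺ φ
    translate f (hyp h)  = f h
    translate f (ax a)   = translate-axiom a
    translate f (mp d e) = mp (translate f d) (translate f e)

  module _ {m : Elem A → Elem B} where

    τ⁺-body : ∀ ps ns → (∀ e → e ∈ ps ++ ns → τ⁺ (elemF e) ≡ elemF (m e)) →
      τ⁺ (⋀ (map elemF ps ++ map (¬ᶠ_ ∘ elemF) ns))
        ≡ ⋀ (map elemF (map m ps) ++ map (¬ᶠ_ ∘ elemF) (map m ns))
    τ⁺-body []       []       h = refl
    τ⁺-body []       (n ∷ ns) h =
      cong₂ _∧ᶠ_ (cong (_⇒ᶠ ⊥ᶠ) (h n (here refl))) (τ⁺-body [] ns (λ e i → h e (there i)))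
    τ⁺-body (p ∷ ps) ns       h = cong₂ _∧ᶠ_ (h p (here refl)) (τ⁺-body ps ns (λ e i → h e (there i)))

    τ⁺-ruleF : ∀ (r : Rule A) (hd : Head B) → τ⁺ (headF (head r)) ≡ headF hd →
      (∀ e → e ∈ pos r ++ neg r → τ⁺ (elemF e) ≡ elemF (m e)) →
      τ⁺ (ruleF r) ≡ ruleF (rule hd (map m (pos r)) (map m (neg r)))
    τ⁺-ruleF r hd eh h = cong₂ _⇒ᶠ_ (τ⁺-body (pos r) (neg r) h) eh

-- Here-and-there semantics of N2

data World : Set where
  H T : World

module _ {A : Set} where

  valueAt : (hv tv : Lit A → Bool) → World → Lit A → Bool
  valueAt hv tv H = hv
  valueAt hv tv T = tv

  -- hv and tv are the literals true at the worlds H ≤ T; the Boolean argument selects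
  -- verification (true) or falsification (false) of the formula, which ∼ swaps.
  eval : (hv tv : Lit A → Bool) → World → Bool → Form A → Bool
  eval hv tv w true  (atomᶠ a) = valueAt hv tv w (+ℓ a)
  eval hv tv w false (atomᶠ a) = valueAt hv tv w (-ℓ a)
  eval hv tv w true  ⊥ᶠ = false
  eval hv tv w false ⊥ᶠ = true
  eval hv tv w true  ⊤ᶠ = true
  eval hv tv w false ⊤ᶠ = false
  eval hv tv w true  (φ ∧ᶠ ψ) = eval hv tv w true φ ∧ eval hv tv w true ψ
  eval hv tv w false (φ ∧ᶠ ψ) = eval hv tv w false φ ∨ eval hv tv w false ψ
  eval hv tv w true  (φ ∨ᶠ ψ) = eval hv tv w true φ ∨ eval hv tv w true ψ
  eval hv tv w false (φ ∨ᶠ ψ) = eval hv tv w false φ ∧ eval hv tv w false ψ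
  eval hv tv w true  (φ ⇒ᶠ ψ) =
    (eval hv tv w true φ ⇒ᵇ eval hv tv w true ψ) ∧ (eval hv tv T true φ ⇒ᵇ eval hv tv T true ψ)
  eval hv tv w false (φ ⇒ᶠ ψ) = eval hv tv w true φ ∧ eval hv tv w false ψ
  eval hv tv w s     (∼ᶠ φ)   = eval hv tv w (not s) φ

  Persistent : (hv tv : Lit A → Bool) → Set
  Persistent hv tv = ∀ l → hv l ≡ true → tv l ≡ true

  Coherent : (Lit A → Bool) → Set
  Coherent tv = ∀ a → tv (+ℓ a) ∧ tv (-ℓ a) ≡ false

  eval-persistent : ∀ {hv tv} → Persistent hv tv →
                    ∀ s φ → eval hv tv H s φ ≡ true → eval hv tv T s φ ≡ true
  eval-persistent p true  (atomᶠ a) e = p _ e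
  eval-persistent p false (atomᶠ a) e = p _ e
  eval-persistent p false ⊥ᶠ e = refl
  eval-persistent p true  ⊤ᶠ e = refl
  eval-persistent p true  (φ ∧ᶠ ψ) e =
    ∧-true⁺ (eval-persistent p true φ (proj₁ (∧-true⁻ e))) (eval-persistent p true ψ (proj₂ (∧-true⁻ e)))
  eval-persistent p false (φ ∧ᶠ ψ) e with ∨-true⁻ e
  ... | inj₁ x = ∨-trueˡ (eval-persistent p false φ x)
  ... | inj₂ y = ∨-trueʳ (eval-persistent p false ψ y)
  eval-persistent p true  (φ ∨ᶠ ψ) e with ∨-true⁻ e
  ... | inj₁ x = ∨-trueˡ (eval-persistent p true φ x)
  ... | inj₂ y = ∨-trueʳ (eval-persistent p true ψ y)
  eval-persistent p false (φ ∨ᶠ ψ) e =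
    ∧-true⁺ (eval-persistent p false φ (proj₁ (∧-true⁻ e))) (eval-persistent p false ψ (proj₂ (∧-true⁻ e)))
  eval-persistent {hv} {tv} p true (φ ⇒ᶠ ψ) e =
    let atT = proj₂ (∧-true⁻ {eval hv tv H true φ ⇒ᵇ eval hv tv H true ψ} e) in ∧-true⁺ atT atT
  eval-persistent p false (φ ⇒ᶠ ψ) e =
    ∧-true⁺ (eval-persistent p true φ (proj₁ (∧-true⁻ e))) (eval-persistent p false ψ (proj₂ (∧-true⁻ e)))
  eval-persistent p true  (∼ᶠ φ) e = eval-persistent p false φ e
  eval-persistent p false (∼ᶠ φ) e = eval-persistent p true φ e

  eval-cong : ∀ {hv tv hv′ tv′} → (∀ l → hv l ≡ hv′ l) → (∀ l → tv l ≡ tv′ l) →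
              ∀ w s φ → eval hv tv w s φ ≡ eval hv′ tv′ w s φ
  eval-cong eh et H true  (atomᶠ a) = eh _
  eval-cong eh et H false (atomᶠ a) = eh _
  eval-cong eh et T true  (atomᶠ a) = et _
  eval-cong eh et T false (atomᶠ a) = et _
  eval-cong eh et w true  ⊥ᶠ = refl
  eval-cong eh et w false ⊥ᶠ = refl
  eval-cong eh et w true  ⊤ᶠ = refl
  eval-cong eh et w false ⊤ᶠ = refl
  eval-cong eh et w true  (φ ∧ᶠ ψ) = cong₂ _∧_ (eval-cong eh et w true φ) (eval-cong eh et w true ψ)
  eval-cong eh et w false (φ ∧ᶠ ψ) = cong₂ _∨_ (eval-cong eh et w false φ) (eval-cong eh et w false ψ)
  eval-cong eh et w true  (φ ∨ᶠ ψ) = cong₂ _∨_ (eval-cong eh et w true φ) (eval-cong eh et w true ψ)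
  eval-cong eh et w false (φ ∨ᶠ ψ) = cong₂ _∧_ (eval-cong eh et w false φ) (eval-cong eh et w false ψ)
  eval-cong eh et w true  (φ ⇒ᶠ ψ) =
    cong₂ _∧_ (cong₂ _⇒ᵇ_ (eval-cong eh et w true φ) (eval-cong eh et w true ψ))
              (cong₂ _⇒ᵇ_ (eval-cong eh et T true φ) (eval-cong eh et T true ψ))
  eval-cong eh et w false (φ ⇒ᶠ ψ) = cong₂ _∧_ (eval-cong eh et w true φ) (eval-cong eh et w false ψ)
  eval-cong eh et w true  (∼ᶠ φ) = eval-cong eh et w false φ
  eval-cong eh et w false (∼ᶠ φ) = eval-cong eh et w true φ

substᶠ : ∀ {C A : Set} → (C → Form A) → Form C → Form A
substᶠ θ (atomᶠ c) = θ c
substᶠ θ ⊥ᶠ        = ⊥ᶠ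
substᶠ θ ⊤ᶠ        = ⊤ᶠ
substᶠ θ (φ ∧ᶠ ψ)  = substᶠ θ φ ∧ᶠ substᶠ θ ψ
substᶠ θ (φ ∨ᶠ ψ)  = substᶠ θ φ ∨ᶠ substᶠ θ ψ
substᶠ θ (φ ⇒ᶠ ψ)  = substᶠ θ φ ⇒ᶠ substᶠ θ ψ
substᶠ θ (∼ᶠ φ)    = ∼ᶠ substᶠ θ φ

-- Whether a formula is verified (⁺) or falsified (⁻) at H and at T.
record Profile : Set where
  constructor profile
  field h⁺ h⁻ t⁺ t⁻ : Bool
open Profile

PersistentProfile : Profile → Set
PersistentProfile v = ((h⁺ v ⇒ᵇ t⁺ v) ∧ (h⁻ v ⇒ᵇ t⁻ v)) ≡ true

profileH profileT : ∀ {C : Set} → (C → Profile) → Lit C → Bool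
profileH v (+ℓ c) = h⁺ (v c)
profileH v (-ℓ c) = h⁻ (v c)
profileT v (+ℓ c) = t⁺ (v c)
profileT v (-ℓ c) = t⁻ (v c)

module _ {C A : Set} (hv tv : Lit A → Bool) (θ : C → Form A) where

  profileOf : C → Profile
  profileOf c = profile (eval hv tv H true (θ c)) (eval hv tv H false (θ c))
                        (eval hv tv T true (θ c)) (eval hv tv T false (θ c))

  eval-substᶠ : ∀ w s φ → eval hv tv w s (substᶠ θ φ) ≡ eval (profileH profileOf) (profileT profileOf) w s φ
  eval-substᶠ H true  (atomᶠ a) = refl
  eval-substᶠ H false (atomᶠ a) = refl
  eval-substᶠ T true  (atomᶠ a) = refl
  eval-substᶠ T false (atomᶠ a) = refl
  eval-substᶠ w true  ⊥ᶠ = refl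
  eval-substᶠ w false ⊥ᶠ = refl
  eval-substᶠ w true  ⊤ᶠ = refl
  eval-substᶠ w false ⊤ᶠ = refl
  eval-substᶠ w true  (φ ∧ᶠ ψ) = cong₂ _∧_ (eval-substᶠ w true φ) (eval-substᶠ w true ψ)
  eval-substᶠ w false (φ ∧ᶠ ψ) = cong₂ _∨_ (eval-substᶠ w false φ) (eval-substᶠ w false ψ)
  eval-substᶠ w true  (φ ∨ᶠ ψ) = cong₂ _∨_ (eval-substᶠ w true φ) (eval-substᶠ w true ψ)
  eval-substᶠ w false (φ ∨ᶠ ψ) = cong₂ _∧_ (eval-substᶠ w false φ) (eval-substᶠ w false ψ)
  eval-substᶠ w true  (φ ⇒ᶠ ψ) =
    cong₂ _∧_ (cong₂ _⇒ᵇ_ (eval-substᶠ w true φ) (eval-substᶠ w true ψ))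
              (cong₂ _⇒ᵇ_ (eval-substᶠ T true φ) (eval-substᶠ T true ψ))
  eval-substᶠ w false (φ ⇒ᶠ ψ) = cong₂ _∧_ (eval-substᶠ w true φ) (eval-substᶠ w false ψ)
  eval-substᶠ w true  (∼ᶠ φ) = eval-substᶠ w false φ
  eval-substᶠ w false (∼ᶠ φ) = eval-substᶠ w true φ

  profileOf-persistent : Persistent hv tv → ∀ c → PersistentProfile (profileOf c)
  profileOf-persistent p c =
    ∧-true⁺ (⇒ᵇ-intro (eval-persistent p true (θ c))) (⇒ᵇ-intro (eval-persistent p false (θ c)))

persistentProfiles : List Profile
persistentProfiles =
    profile false false false false ∷ profile false false false true ∷ profile false false true false
  ∷ profile false false true  true  ∷ profile false true  false true ∷ profile false true  true true
  ∷ profile true  false true  false ∷ profile true  false true  true ∷ profile true  true  true true ∷ []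

∈-persistentProfiles : ∀ v → PersistentProfile v → v ∈ persistentProfiles
∈-persistentProfiles (profile false false false false) _ = here refl
∈-persistentProfiles (profile false false false true)  _ = there (here refl)
∈-persistentProfiles (profile false false true  false) _ = there (there (here refl))
∈-persistentProfiles (profile false false true  true)  _ = there (there (there (here refl)))
∈-persistentProfiles (profile false true  false true)  _ = there (there (there (there (here refl))))
∈-persistentProfiles (profile false true  true  true)  _ = there (there (there (there (there (here refl)))))
∈-persistentProfiles (profile true  false true  false) _ =
  there (there (there (there (there (there (here refl))))))
∈-persistentProfiles (profile true  false true  true)  _ =
  there (there (there (there (there (there (there (here refl)))))))
∈-persistentProfiles (profile true  true  true  true)  _ =
  there (there (there (there (there (there (there (there (here refl))))))))
∈-persistentProfiles (profile false true  false false) ()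
∈-persistentProfiles (profile false true  true  false) ()
∈-persistentProfiles (profile true  false false false) ()
∈-persistentProfiles (profile true  false false true)  ()
∈-persistentProfiles (profile true  true  false false) ()
∈-persistentProfiles (profile true  true  false true)  ()
∈-persistentProfiles (profile true  true  true  false) ()

forAllProfiles : (k : ℕ) → ((Fin k → Profile) → Bool) → Bool
forAllProfiles zero    g = g (λ ())
forAllProfiles (suc k) g = all (λ a → forAllProfiles k (λ v → g (a Vector.∷ v))) persistentProfiles

forAllProfiles-sound : ∀ k (g : (Fin k → Profile) → Bool) →
  (∀ v v′ → (∀ i → v i ≡ v′ i) → g v ≡ g v′) →
  forAllProfiles k g ≡ true → ∀ v → (∀ i → PersistentProfile (v i)) → g v ≡ true
forAllProfiles-sound zero    g resp e v p = trans (resp v (λ ()) (λ ())) e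
forAllProfiles-sound (suc k) g resp e v p =
  trans (resp v (v zero Vector.∷ (v ∘ suc)) λ { zero → refl ; (suc i) → refl })
        (forAllProfiles-sound k (λ u → g (v zero Vector.∷ u))
           (λ u u′ eu → resp _ _ λ { zero → refl ; (suc i) → eu i })
           (All.lookup (all-true⁻ (λ a → forAllProfiles k (λ u → g (a Vector.∷ u))) persistentProfiles e)
                       (∈-persistentProfiles (v zero) (p zero)))
           (v ∘ suc) (p ∘ suc))

-- φ, read as a schema in the variables Fin k, is valid in all here-and-there models: a schema
-- instance only sees the profiles of the substituted formulas, and these are persistent.
valid? : ∀ {k} → Form (Fin k) → Bool
valid? {k} φ = forAllProfiles k λ v →
  eval (profileH v) (profileT v) H true φ ∧ eval (profileH v) (profileT v) T true φ

valid?-sound : ∀ {A : Set} {hv tv : Lit A → Bool} {k} (φ : Form (Fin k)) → valid? φ ≡ true →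
  (θ : Fin k → Form A) → Persistent hv tv → ∀ w → eval hv tv w true (substᶠ θ φ) ≡ true
valid?-sound {hv = hv} {tv} {k} φ ok θ p w = trans (eval-substᶠ hv tv θ w true φ) (atWorld w)
  where
  v : Fin k → Profile
  v = profileOf hv tv θ
  eval-cong-profile : ∀ {u u′ : Fin k → Profile} → (∀ i → u i ≡ u′ i) → ∀ w →
    eval (profileH u) (profileT u) w true φ ≡ eval (profileH u′) (profileT u′) w true φ
  eval-cong-profile e = λ w → eval-cong
    (λ { (+ℓ c) → cong h⁺ (e c) ; (-ℓ c) → cong h⁻ (e c) })
    (λ { (+ℓ c) → cong t⁺ (e c) ; (-ℓ c) → cong t⁻ (e c) }) w true φ
  atBoth : eval (profileH v) (profileT v) H true φ ∧ eval (profileH v) (profileT v) T true φ ≡ true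
  atBoth = forAllProfiles-sound k _
    (λ u u′ e → cong₂ _∧_ (eval-cong-profile e H) (eval-cong-profile e T)) ok
    v (profileOf-persistent hv tv θ p)
  atWorld : ∀ w → eval (profileH v) (profileT v) w true φ ≡ true
  atWorld H = proj₁ (∧-true⁻ atBoth)
  atWorld T = proj₂ (∧-true⁻ atBoth)

x₀ : ∀ {k} → Form (Fin (suc k))
x₀ = atomᶠ zero

x₁ : ∀ {k} → Form (Fin (suc (suc k)))
x₁ = atomᶠ (suc zero)

x₂ : ∀ {k} → Form (Fin (suc (suc (suc k))))
x₂ = atomᶠ (suc (suc zero))

coherent⇒nelson-atom : ∀ x y t⁺ t⁻ → (x ≡ true → t⁺ ≡ true) → (y ≡ true → t⁻ ≡ true) → t⁺ ∧ t⁻ ≡ false →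
  ((y ⇒ᵇ (x ⇒ᵇ false) ∧ (t⁺ ⇒ᵇ false)) ∧ (t⁻ ⇒ᵇ (t⁺ ⇒ᵇ false) ∧ (t⁺ ⇒ᵇ false))) ≡ true
coherent⇒nelson-atom x     false t⁺    false _  _  _  = refl
coherent⇒nelson-atom x     true  t⁺    false _  py _  = contradiction (py refl) false≢true
coherent⇒nelson-atom false false false true  _  _  _  = refl
coherent⇒nelson-atom false true  false true  _  _  _  = refl
coherent⇒nelson-atom true  y     false true  px _  _  = contradiction (px refl) false≢true
coherent⇒nelson-atom x     y     true  true  _  _  ()

module _ {A : Set} {hv tv : Lit A → Bool} (pers : Persistent hv tv) (coh : Coherent tv) where

  axiom-valid : ∀ {φ} → Axiom φ → ∀ w → eval hv tv w true φ ≡ true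
  axiom-valid (axK α β)    = valid?-sound (x₀ ⇒ᶠ x₁ ⇒ᶠ x₀) refl (lookup (α ∷ᵛ β ∷ᵛ []ᵛ)) pers
  axiom-valid (axS α β γ)  =
    valid?-sound ((x₀ ⇒ᶠ x₁ ⇒ᶠ x₂) ⇒ᶠ (x₀ ⇒ᶠ x₁) ⇒ᶠ x₀ ⇒ᶠ x₂) refl (lookup (α ∷ᵛ β ∷ᵛ γ ∷ᵛ []ᵛ)) pers
  axiom-valid (ax∧I α β)   = valid?-sound (x₀ ⇒ᶠ x₁ ⇒ᶠ x₀ ∧ᶠ x₁) refl (lookup (α ∷ᵛ β ∷ᵛ []ᵛ)) pers
  axiom-valid (ax∧E₁ α β)  = valid?-sound (x₀ ∧ᶠ x₁ ⇒ᶠ x₀) refl (lookup (α ∷ᵛ β ∷ᵛ []ᵛ)) pers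
  axiom-valid (ax∧E₂ α β)  = valid?-sound (x₀ ∧ᶠ x₁ ⇒ᶠ x₁) refl (lookup (α ∷ᵛ β ∷ᵛ []ᵛ)) pers
  axiom-valid (ax∨I₁ α β)  = valid?-sound (x₀ ⇒ᶠ x₀ ∨ᶠ x₁) refl (lookup (α ∷ᵛ β ∷ᵛ []ᵛ)) pers
  axiom-valid (ax∨I₂ α β)  = valid?-sound (x₁ ⇒ᶠ x₀ ∨ᶠ x₁) refl (lookup (α ∷ᵛ β ∷ᵛ []ᵛ)) pers
  axiom-valid (ax∨E α β γ) =
    valid?-sound ((x₀ ⇒ᶠ x₂) ⇒ᶠ (x₁ ⇒ᶠ x₂) ⇒ᶠ x₀ ∨ᶠ x₁ ⇒ᶠ x₂) refl (lookup (α ∷ᵛ β ∷ᵛ γ ∷ᵛ []ᵛ)) pers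
  axiom-valid (ax⊥E α)     = valid?-sound (⊥ᶠ ⇒ᶠ x₀) refl (lookup (α ∷ᵛ []ᵛ)) pers
  axiom-valid ax⊤          = λ _ → refl
  axiom-valid (axN⇒ α β)   = valid?-sound (∼ᶠ (x₀ ⇒ᶠ x₁) ⇔ᶠ x₀ ∧ᶠ ∼ᶠ x₁) refl (lookup (α ∷ᵛ β ∷ᵛ []ᵛ)) pers
  axiom-valid (axN∧ α β)   = valid?-sound (∼ᶠ (x₀ ∧ᶠ x₁) ⇔ᶠ ∼ᶠ x₀ ∨ᶠ ∼ᶠ x₁) refl (lookup (α ∷ᵛ β ∷ᵛ []ᵛ)) pers
  axiom-valid (axN∨ α β)   = valid?-sound (∼ᶠ (x₀ ∨ᶠ x₁) ⇔ᶠ ∼ᶠ x₀ ∧ᶠ ∼ᶠ x₁) refl (lookup (α ∷ᵛ β ∷ᵛ []ᵛ)) pers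
  axiom-valid (axN∼∼ α)    = valid?-sound (x₀ ⇔ᶠ ∼ᶠ ∼ᶠ x₀) refl (lookup (α ∷ᵛ []ᵛ)) pers
  axiom-valid (axN∼¬ α)    = valid?-sound (∼ᶠ (¬ᶠ x₀) ⇔ᶠ x₀) refl (lookup (α ∷ᵛ []ᵛ)) pers
  axiom-valid (axN2 α β)   = valid?-sound (x₀ ∨ᶠ (x₀ ⇒ᶠ x₁) ∨ᶠ ¬ᶠ x₁) refl (lookup (α ∷ᵛ β ∷ᵛ []ᵛ)) pers
  axiom-valid (axNat a) H  =
    coherent⇒nelson-atom (hv (+ℓ a)) (hv (-ℓ a)) (tv (+ℓ a)) (tv (-ℓ a)) (pers _) (pers _) (coh a)
  axiom-valid (axNat a) T  =
    coherent⇒nelson-atom (tv (+ℓ a)) (tv (-ℓ a)) (tv (+ℓ a)) (tv (-ℓ a)) (λ e → e) (λ e → e) (coh a)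

  soundness : ∀ {Γ : Theory {A}} → (∀ {ψ} → Γ ψ → eval hv tv H true ψ ≡ true) →
              ∀ {φ} → Γ ⊢ φ → ∀ w → eval hv tv w true φ ≡ true
  soundness f (hyp h)          H = f h
  soundness f (hyp {φ} h)      T = eval-persistent pers true φ (f h)
  soundness f (ax a)           w = axiom-valid a w
  soundness f (mp {φ} {ψ} d e) w =
    ⇒ᵇ-elim (proj₁ (∧-true⁻ {eval hv tv w true φ ⇒ᵇ eval hv tv w true ψ} (soundness f d w))) (soundness f e w)

module _ {A : Set} {hv tv : Lit A → Bool} where

  eval-litF : ∀ w l → eval hv tv w true (litF l) ≡ valueAt hv tv w l
  eval-litF w (+ℓ a) = refl
  eval-litF w (-ℓ a) = refl

  eval-¬¬ : ∀ w φ → eval hv tv T true φ ≡ true → eval hv tv w true (¬ᶠ ¬ᶠ φ) ≡ true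
  eval-¬¬ w φ e rewrite e with eval hv tv w true φ
  ... | true  = refl
  ... | false = refl

  eval-¬ : Persistent hv tv → ∀ w φ → eval hv tv T true φ ≡ false → eval hv tv w true (¬ᶠ φ) ≡ true
  eval-¬ p H φ e with eval hv tv H true φ in eH
  ... | true  = contradiction (trans (sym e) (eval-persistent p true φ eH)) false≢true
  ... | false rewrite e = refl
  eval-¬ p T φ e rewrite e = refl

  eval-¬⁻ : ∀ w φ → eval hv tv w true (¬ᶠ φ) ≡ true → eval hv tv T true φ ≡ false
  eval-¬⁻ w φ e with eval hv tv w true φ | eval hv tv T true φ
  ... | false | false = refl

  eval-⋀⁻ : ∀ w φs → eval hv tv w true (⋀ φs) ≡ true → All (λ φ → eval hv tv w true φ ≡ true) φs
  eval-⋀⁻ w []       _ = []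
  eval-⋀⁻ w (φ ∷ φs) e with ∧-true⁻ {eval hv tv w true φ} e
  ... | eφ , eφs = eφ ∷ eval-⋀⁻ w φs eφs

  eval-⋀⁺ : ∀ w {φs} → All (λ φ → eval hv tv w true φ ≡ true) φs → eval hv tv w true (⋀ φs) ≡ true
  eval-⋀⁺ w []       = refl
  eval-⋀⁺ w (e ∷ es) = ∧-true⁺ e (eval-⋀⁺ w es)

  eval-body⁻ : ∀ w r → eval hv tv w true (bodyF r) ≡ true →
    All (λ e → eval hv tv w true (elemF e) ≡ true) (pos r) ×
    All (λ e → eval hv tv w true (¬ᶠ elemF e) ≡ true) (neg r)
  eval-body⁻ w r e with All.++⁻ (map elemF (pos r)) (eval-⋀⁻ w (bodyConjuncts r) e)
  ... | ep , en = All.map⁻ ep , All.map⁻ en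

  eval-body⁺ : ∀ w r → All (λ e → eval hv tv w true (elemF e) ≡ true) (pos r) →
    All (λ e → eval hv tv w true (¬ᶠ elemF e) ≡ true) (neg r) → eval hv tv w true (bodyF r) ≡ true
  eval-body⁺ w r ep en = eval-⋀⁺ w (All.++⁺ (All.map⁺ ep) (All.map⁺ en))

atomOf-mapLit : ∀ {A B : Set} (f : A → B) L → atomOf (mapLit f L) ≡ f (atomOf L)
atomOf-mapLit f (+ℓ a) = refl
atomOf-mapLit f (-ℓ a) = refl

atomOf-compl : ∀ {A : Set} (L : Lit A) → atomOf (compl L) ≡ atomOf L
atomOf-compl (+ℓ a) = refl
atomOf-compl (-ℓ a) = refl

module _ {A : Set} where

  hlit-injective : ∀ {L L′ : Lit A} → hlit L ≡ hlit L′ → L ≡ L′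
  hlit-injective refl = refl

  head∈elemsOf : ∀ (r : Rule A) {L} → head r ≡ hlit L → lit L ∈ elemsOf r
  head∈elemsOf r e = subst (λ h → lit _ ∈ headElem h ∷ (pos r ++ neg r)) (sym e) (here refl)

  pos∈elemsOf : ∀ (r : Rule A) {L} → lit L ∈ pos r → lit L ∈ elemsOf r
  pos∈elemsOf r m = there (∈-++⁺ˡ m)

  neg∈elemsOf : ∀ (r : Rule A) {L} → lit L ∈ neg r → lit L ∈ elemsOf r
  neg∈elemsOf r m = there (∈-++⁺ʳ (pos r) m)

  atomOccurs : ∀ {P : Program A} {r l} → r ∈ P → lit l ∈ elemsOf r → AtomOccurs (atomOf l) P
  atomOccurs r∈P m = _ , (_ , r∈P , m) , refl

  ElemTrue ElemFalse : (Lit A → Set) → Elem A → Set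
  ElemTrue S (lit l) = S l
  ElemTrue S top     = ⊤
  ElemTrue S bot     = ⊥
  ElemFalse S (lit l) = ¬ S l
  ElemFalse S top     = ⊥
  ElemFalse S bot     = ⊤

  BodyTrue : (Lit A → Set) → Rule A → Set
  BodyTrue S r = All (ElemTrue S) (pos r) × All (ElemFalse S) (neg r)

  Agrees : (Lit A → Bool) → (Lit A → Set) → Set
  Agrees σ S = ∀ l → (σ l ≡ true → S l) × (S l → σ l ≡ true)

  AtomOccurs-mono : ∀ {a} {P Q : Program A} → (∀ {r} → r ∈ P → r ∈ Q) → AtomOccurs a P → AtomOccurs a Q
  AtomOccurs-mono P⊆Q (L , (r , r∈P , m) , e) = L , (r , P⊆Q r∈P , m) , e

  answerTheory-mono : ∀ {P Q : Program A} {S ψ} → (∀ {r} → r ∈ P → r ∈ Q) →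
                      answerTheory P S ψ → answerTheory Q S ψ
  answerTheory-mono P⊆Q (inj₁ (r , r∈P , e))             = inj₁ (r , P⊆Q r∈P , e)
  answerTheory-mono P⊆Q (inj₂ (inj₁ (l , occ , ¬s , e))) = inj₂ (inj₁ (l , AtomOccurs-mono P⊆Q occ , ¬s , e))
  answerTheory-mono P⊆Q (inj₂ (inj₂ p))                  = inj₂ (inj₂ p)

  module AnswerSetFields {P : Program A} {S : Lit A → Set} (as : AnswerSet P S) where

    occurs : ∀ l → S l → AtomOccurs (atomOf l) P
    occurs = proj₁ as

    consistent : ConsistentLits S
    consistent = proj₁ (proj₂ as)

    N2-consistency : N2-consistent (answerTheory P S)
    N2-consistency = proj₁ (proj₂ (proj₂ as))

    derives : ∀ l → S l → answerTheory P S ⊢ litF l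
    derives = proj₂ (proj₂ (proj₂ as))

  module _ {P : Program A} {S : Lit A → Set} where

    ⊢-rule : ∀ {r} → r ∈ P → answerTheory P S ⊢ ruleF r
    ⊢-rule r∈P = hyp (inj₁ (_ , r∈P , refl))

    ⊢-¬lit : ∀ {l} → AtomOccurs (atomOf l) P → ¬ S l → answerTheory P S ⊢ ¬ᶠ litF l
    ⊢-¬lit occ ¬s = hyp (inj₂ (inj₁ (_ , occ , ¬s , refl)))

module AnswerSets {A : Set} (_≟_ : DecidableEquality A) where

  _≟ℓ_ : DecidableEquality (Lit A)
  +ℓ a ≟ℓ +ℓ b = Dec.map′ (cong +ℓ) (λ { refl → refl }) (a ≟ b)
  +ℓ a ≟ℓ -ℓ b = no λ ()
  -ℓ a ≟ℓ +ℓ b = no λ ()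
  -ℓ a ≟ℓ -ℓ b = Dec.map′ (cong -ℓ) (λ { refl → refl }) (a ≟ b)

  elemAtomLits : Elem A → List (Lit A)
  elemAtomLits (lit L) = L ∷ compl L ∷ []
  elemAtomLits top     = []
  elemAtomLits bot     = []

  atomLits : Program A → List (Lit A)
  atomLits = concatMap (concatMap elemAtomLits ∘ elemsOf)

  ∈-atomLits⁺ : ∀ {P l} → AtomOccurs (atomOf l) P → l ∈ atomLits P
  ∈-atomLits⁺ {l = l} (L , (r , r∈P , L∈r) , eq) =
    ∈-concatMap⁺ _ (lose r∈P (∈-concatMap⁺ _ (lose L∈r (sameAtom L l eq))))
    where
    sameAtom : ∀ L l → atomOf L ≡ atomOf l → l ∈ elemAtomLits (lit L)
    sameAtom (+ℓ a) (+ℓ .a) refl = here refl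
    sameAtom (+ℓ a) (-ℓ .a) refl = there (here refl)
    sameAtom (-ℓ a) (+ℓ .a) refl = there (here refl)
    sameAtom (-ℓ a) (-ℓ .a) refl = here refl

  ∈-atomLits⁻ : ∀ {P l} → l ∈ atomLits P → AtomOccurs (atomOf l) P
  ∈-atomLits⁻ {P} m with find (∈-concatMap⁻ _ {P} m)
  ... | r , r∈P , m′ with find (∈-concatMap⁻ _ {elemsOf r} m′)
  ...   | lit L , L∈r , here refl         = L , (r , r∈P , L∈r) , refl
  ...   | lit L , L∈r , there (here refl) = L , (r , r∈P , L∈r) , sym (atomOf-compl L)

  atomOccurs? : ∀ a P → Dec (AtomOccurs a P)
  atomOccurs? a P = Dec.map′ ∈-atomLits⁻ ∈-atomLits⁺ (any? (+ℓ a ≟ℓ_) (atomLits P))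

  ¬¬-decidable-on : (S : Lit A → Set) (Λ : List (Lit A)) → ¬ ¬ All (λ l → Dec (S l)) Λ
  ¬¬-decidable-on S []      k = k []
  ¬¬-decidable-on S (l ∷ Λ) k = ¬¬-decidable-on S Λ λ ds → Dec.¬¬-excluded-middle λ d → k (d ∷ ds)

  module _ {S : Lit A → Set} {Λ : List (Lit A)} (ds : All (λ l → Dec (S l)) Λ) where

    decideOn : Lit A → Bool
    decideOn l with any? (l ≟ℓ_) Λ
    ... | yes l∈Λ = does (All.lookup ds l∈Λ)
    ... | no  _   = false

    decideOn-sound : ∀ l → decideOn l ≡ true → S l
    decideOn-sound l e with any? (l ≟ℓ_) Λ
    ... | yes l∈Λ = does-true⁻ (All.lookup ds l∈Λ) e

    decideOn-complete : ∀ l → l ∈ Λ → S l → decideOn l ≡ true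
    decideOn-complete l l∈Λ s with any? (l ≟ℓ_) Λ
    ... | yes l∈Λ′ = Dec.dec-true (All.lookup ds l∈Λ′) s
    ... | no  l∉Λ  = contradiction l∈Λ l∉Λ

  -- S need not be decidable, so an agreeing valuation exists only under ¬¬; that suffices for refutations.
  ¬¬-agreeing : ∀ {P S} → AnswerSet P S → ¬ ¬ (∃ λ σ → Agrees σ S)
  ¬¬-agreeing {P} {S} as k = ¬¬-decidable-on S (atomLits P) λ ds →
    k (decideOn ds , λ l → decideOn-sound ds l , λ s → decideOn-complete ds l (∈-atomLits⁺ (occurs l s)) s)
    where open AnswerSetFields as

  module Agreeing {P : Program A} {S : Lit A → Set} (as : AnswerSet P S) (σ : Lit A → Bool) (ag : Agrees σ S)
    where
    open AnswerSetFields as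

    σ-false : ∀ {l} → ¬ S l → σ l ≡ false
    σ-false ¬s = ¬-not (¬s ∘ proj₁ (ag _))

    σ-coherent : Coherent σ
    σ-coherent a with σ (+ℓ a) in e⁺ | σ (-ℓ a) in e⁻
    ... | true  | true  = ⊥-elim (consistent a (proj₁ (ag _) e⁺) (proj₁ (ag _) e⁻))
    ... | true  | false = refl
    ... | false | _     = refl

    derive-body-at-T : ∀ {hv r} → r ∈ P → eval hv σ T true (bodyF r) ≡ true → answerTheory P S ⊢ bodyF r
    derive-body-at-T {hv} {r} r∈P eb =
      ⊢-body {r = r} (All.map (λ {e} → derive-pos {e}) ep) (All.tabulate λ m → derive-neg m (All.lookup en m))
      where
      ep : All (λ e → eval hv σ T true (elemF e) ≡ true) (pos r)
      ep = proj₁ (eval-body⁻ T r eb)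
      en : All (λ e → eval hv σ T true (¬ᶠ elemF e) ≡ true) (neg r)
      en = proj₂ (eval-body⁻ T r eb)
      derive-pos : ∀ {e} → eval hv σ T true (elemF e) ≡ true → answerTheory P S ⊢ elemF e
      derive-pos {lit l} t = derives l (proj₁ (ag l) (trans (sym (eval-litF T l)) t))
      derive-pos {top}   _ = ax ax⊤
      derive-neg : ∀ {e} → e ∈ neg r → eval hv σ T true (¬ᶠ elemF e) ≡ true → answerTheory P S ⊢ ¬ᶠ elemF e
      derive-neg {lit l} m t = ⊢-¬lit (atomOccurs r∈P (neg∈elemsOf r m))
        λ s → false≢true (trans (sym (eval-¬⁻ T (litF l) t)) (trans (eval-litF T l) (proj₂ (ag l) s)))
      derive-neg {top} m t = contradiction (eval-¬⁻ {hv = hv} {σ} T ⊤ᶠ t) λ ()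
      derive-neg {bot} m t = ⊢-id

    bodyTrue-at-T : ∀ {hv r} → eval hv σ T true (bodyF r) ≡ true → BodyTrue S r
    bodyTrue-at-T {hv} {r} eb =
      All.map (λ {e} → pos-true {e}) (proj₁ (eval-body⁻ T r eb)) ,
      All.map (λ {e} → neg-true {e}) (proj₂ (eval-body⁻ T r eb))
      where
      pos-true : ∀ {e} → eval hv σ T true (elemF e) ≡ true → ElemTrue S e
      pos-true {lit l} t = proj₁ (ag l) (trans (sym (eval-litF T l)) t)
      pos-true {top}   _ = tt
      neg-true : ∀ {e} → eval hv σ T true (¬ᶠ elemF e) ≡ true → ElemFalse S e
      neg-true {lit l} t s =
        false≢true (trans (sym (eval-¬⁻ T (litF l) t)) (trans (eval-litF T l) (proj₂ (ag l) s)))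
      neg-true {top}   t   = contradiction (eval-¬⁻ {hv = hv} {σ} T ⊤ᶠ t) λ ()
      neg-true {bot}   _   = tt

    rule-holds-at-T : ∀ {hv r} → r ∈ P →
                      eval hv σ T true (bodyF r) ≡ true → eval hv σ T true (headF (head r)) ≡ true
    rule-holds-at-T {hv} {r} r∈P eb = holds (head r) refl
      where
      derived : answerTheory P S ⊢ headF (head r)
      derived = mp (⊢-rule r∈P) (derive-body-at-T r∈P eb)
      holds : ∀ h → head r ≡ h → eval hv σ T true (headF h) ≡ true
      holds hbot     e = ⊥-elim (N2-consistency (subst (λ h → _ ⊢ headF h) e derived))
      holds (hlit L) e with σ L in eL
      ... | true  = trans (eval-litF T L) eL
      ... | false = ⊥-elim (N2-consistency (mp (⊢-¬lit (atomOccurs r∈P (head∈elemsOf r e)) ¬S)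
                                               (subst (λ h → _ ⊢ headF h) e derived)))
        where
        ¬S : ¬ S L
        ¬S s = false≢true (trans (sym eL) (proj₂ (ag L) s))

    module Without (x : Lit A) where

      hv : Lit A → Bool
      hv l = σ l ∧ not (does (l ≟ℓ x))

      hv-persistent : Persistent hv σ
      hv-persistent l e = proj₁ (∧-true⁻ e)

      hv-other : ∀ {l} → l ≢ x → hv l ≡ σ l
      hv-other {l} l≢x = trans (cong (λ b → σ l ∧ not b) (Dec.dec-false (l ≟ℓ x) l≢x)) (∧-identityʳ (σ l))

      x-false : eval hv σ H true (litF x) ≡ false
      x-false = trans (eval-litF H x)
                      (trans (cong (λ b → σ x ∧ not b) (Dec.dec-true (x ≟ℓ x) refl)) (∧-zeroʳ (σ x)))

      rule-holds : ∀ {r} → r ∈ P → (head r ≡ hlit x → ¬ BodyTrue S r) → eval hv σ H true (ruleF r) ≡ true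
      rule-holds {r} r∈P unsupported = ∧-true⁺ (⇒ᵇ-intro atH) (⇒ᵇ-intro (rule-holds-at-T r∈P))
        where
        atH : eval hv σ H true (bodyF r) ≡ true → eval hv σ H true (headF (head r)) ≡ true
        atH eb = lower (head r) refl (rule-holds-at-T r∈P ebT)
          where
          ebT : eval hv σ T true (bodyF r) ≡ true
          ebT = eval-persistent hv-persistent true (bodyF r) eb
          lower : ∀ h → head r ≡ h → eval hv σ T true (headF h) ≡ true → eval hv σ H true (headF h) ≡ true
          lower (hlit L) e t with L ≟ℓ x
          ... | yes refl = ⊥-elim (unsupported e (bodyTrue-at-T {hv} {r} ebT))
          ... | no  L≢x  = trans (eval-litF H L) (trans (hv-other L≢x) (trans (sym (eval-litF T L)) t))

      theory-holds : (∀ {r} → r ∈ P → head r ≡ hlit x → ¬ BodyTrue S r) →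
                     ∀ {φ} → answerTheory P S φ → eval hv σ H true φ ≡ true
      theory-holds unsupported (inj₁ (r , r∈P , refl))         = rule-holds r∈P (unsupported r∈P)
      theory-holds unsupported (inj₂ (inj₁ (l , _ , ¬s , refl))) =
        eval-¬ hv-persistent H (litF l) (trans (eval-litF T l) (σ-false ¬s))
      theory-holds unsupported (inj₂ (inj₂ (l , s , refl)))      =
        eval-¬¬ H (litF l) (trans (eval-litF T l) (proj₂ (ag l) s))

      body-holds : ∀ {r} → BodyTrue S r → (∀ {l} → lit l ∈ pos r → l ≢ x) → eval hv σ H true (bodyF r) ≡ true
      body-holds {r} (bp , bn) x∉pos =
        eval-body⁺ H r (All.tabulate λ m → pos-holds m (All.lookup bp m)) (All.map (λ {e} → neg-holds {e}) bn)
        where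
        pos-holds : ∀ {e} → e ∈ pos r → ElemTrue S e → eval hv σ H true (elemF e) ≡ true
        pos-holds {lit l} m s = trans (eval-litF H l) (trans (hv-other (x∉pos m)) (proj₂ (ag l) s))
        pos-holds {top}   _ _ = refl
        neg-holds : ∀ {e} → ElemFalse S e → eval hv σ H true (¬ᶠ elemF e) ≡ true
        neg-holds {lit l} ¬s = eval-¬ hv-persistent H (litF l) (trans (eval-litF T l) (σ-false ¬s))
        neg-holds {bot}   _  = refl

  answerSet-supported : ∀ {P S x} → AnswerSet P S → S x → ¬ (∀ {r} → r ∈ P → head r ≡ hlit x → ¬ BodyTrue S r)
  answerSet-supported {x = x} as sx unsupported = ¬¬-agreeing as λ (σ , ag) →
    let open Agreeing as σ ag
        open Without x
    in false≢true (trans (sym x-false)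
         (soundness hv-persistent σ-coherent (theory-holds unsupported) (AnswerSetFields.derives as x sx) H))

  -- The here-world σ without x satisfies Q and the body of r₀ but not x.
  answerSet-needs-head : ∀ {P S x} → AnswerSet P S → S x → (Q : Program A) → (∀ {r} → r ∈ Q → r ∈ P) →
    (∀ {r} → r ∈ Q → head r ≢ hlit x) → ∀ r₀ → progT Q ⊢ bodyF r₀ ⇒ᶠ litF x →
    BodyTrue S r₀ → (∀ {l} → lit l ∈ pos r₀ → l ≢ x) → ⊥
  answerSet-needs-head {x = x} as sx Q Q⊆P no-x-head r₀ d bt x∉pos = ¬¬-agreeing as λ (σ , ag) →
    let open Agreeing as σ ag
        open Without x
        Q-holds : ∀ {ψ} → progT Q ψ → eval hv σ H true ψ ≡ true
        Q-holds = λ { (r , r∈Q , refl) → rule-holds (Q⊆P r∈Q) (λ e → ⊥-elim (no-x-head r∈Q e)) }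
    in false≢true (trans (sym x-false)
         (⇒ᵇ-elim (proj₁ (∧-true⁻ {eval hv σ H true (bodyF r₀) ⇒ᵇ eval hv σ H true (litF x)}
                               (soundness hv-persistent σ-coherent Q-holds d H)))
                  (body-holds {r₀} bt x∉pos)))

module AnswerSetsℕ = AnswerSets ℕ._≟_

_≟ᴱ_ : DecidableEquality (Elem ℕ)
lit a ≟ᴱ lit b = Dec.map′ (cong lit) (λ { refl → refl }) (a AnswerSetsℕ.≟ℓ b)
lit a ≟ᴱ top   = no λ ()
lit a ≟ᴱ bot   = no λ ()
top   ≟ᴱ lit b = no λ ()
top   ≟ᴱ top   = yes refl
top   ≟ᴱ bot   = no λ ()
bot   ≟ᴱ lit b = no λ ()
bot   ≟ᴱ top   = no λ ()
bot   ≟ᴱ bot   = yes refl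

_≟ᴴ_ : DecidableEquality (Head ℕ)
hlit a ≟ᴴ hlit b = Dec.map′ (cong hlit) hlit-injective (a AnswerSetsℕ.≟ℓ b)
hlit a ≟ᴴ hbot   = no λ ()
hbot   ≟ᴴ hlit b = no λ ()
hbot   ≟ᴴ hbot   = yes refl

_≟ᴿ_ : DecidableEquality BRule
rule h p n ≟ᴿ rule h′ p′ n′ with h ≟ᴴ h′ | List.≡-dec _≟ᴱ_ p p′ | List.≡-dec _≟ᴱ_ n n′
... | yes refl | yes refl | yes refl = yes refl
... | no  h≢   | _        | _        = no λ { refl → h≢ refl }
... | yes _    | no  p≢   | _        = no λ { refl → p≢ refl }
... | yes _    | yes _    | no  n≢   = no λ { refl → n≢ refl }

_≟ˣ_ : DecidableEquality XAtom
orig a ≟ˣ orig b = Dec.map′ (cong orig) (λ { refl → refl }) (a ℕ.≟ b)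
one  a ≟ˣ one  b = Dec.map′ (cong one)  (λ { refl → refl }) (a ℕ.≟ b)
two  a ≟ˣ two  b = Dec.map′ (cong two)  (λ { refl → refl }) (a ℕ.≟ b)
rej  r ≟ˣ rej  s = Dec.map′ (cong rej)  (λ { refl → refl }) (r ≟ᴿ s)
orig _ ≟ˣ one  _ = no λ ()
orig _ ≟ˣ two  _ = no λ ()
orig _ ≟ˣ rej  _ = no λ ()
one  _ ≟ˣ orig _ = no λ ()
one  _ ≟ˣ two  _ = no λ ()
one  _ ≟ˣ rej  _ = no λ ()
two  _ ≟ˣ orig _ = no λ ()
two  _ ≟ˣ one  _ = no λ ()
two  _ ≟ˣ rej  _ = no λ ()
rej  _ ≟ˣ orig _ = no λ ()
rej  _ ≟ˣ one  _ = no λ ()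
rej  _ ≟ˣ two  _ = no λ ()

module AnswerSetsˣ = AnswerSets _≟ˣ_

mapLit-atom : ∀ {A B : Set} {f : A → XAtom} {g : B → XAtom} {L L′} →
              mapLit f L ≡ mapLit g L′ → f (atomOf L) ≡ g (atomOf L′)
mapLit-atom {f = f} {g} {L} {L′} e =
  trans (sym (atomOf-mapLit f L)) (trans (cong atomOf e) (atomOf-mapLit g L′))

mapLit-injective : ∀ {f : ℕ → XAtom} → (∀ {a b} → f a ≡ f b → a ≡ b) →
                   ∀ {L L′} → mapLit f L ≡ mapLit f L′ → L ≡ L′
mapLit-injective {f} f-inj {+ℓ _} {+ℓ _} e = cong +ℓ (f-inj (mapLit-atom {f = f} {f} e))
mapLit-injective {f} f-inj { -ℓ _} { -ℓ _} e = cong -ℓ (f-inj (mapLit-atom {f = f} {f} e))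
mapLit-injective f-inj {+ℓ _} { -ℓ _} ()
mapLit-injective f-inj { -ℓ _} {+ℓ _} ()

elemsOf-embed : ∀ r → elemsOf (embed r) ≡ map (mapElem orig) (elemsOf r)
elemsOf-embed (rule h p n) = cong₂ _∷_ (headElem-map h) (sym (List.map-++ (mapElem orig) p n))
  where
  headElem-map : ∀ h → headElem (mapHead orig h) ≡ mapElem orig (headElem h)
  headElem-map (hlit L) = refl
  headElem-map hbot     = refl

embed-lit⁻ : ∀ r {l} → lit l ∈ elemsOf (embed r) → ∃ λ L → lit L ∈ elemsOf r × l ≡ mapLit orig L
embed-lit⁻ r {l} m with ∈-map⁻ (mapElem orig) (subst (lit l ∈_) (elemsOf-embed r) m)
... | lit L , L∈r , refl = L , L∈r , refl

∈-litsOfElems⁺ : ∀ {L es} → lit L ∈ es → L ∈ litsOfElems es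
∈-litsOfElems⁺ {es = lit _ ∷ es} (here refl) = here refl
∈-litsOfElems⁺ {es = lit _ ∷ es} (there m)   = there (∈-litsOfElems⁺ m)
∈-litsOfElems⁺ {es = top   ∷ es} (there m)   = ∈-litsOfElems⁺ m
∈-litsOfElems⁺ {es = bot   ∷ es} (there m)   = ∈-litsOfElems⁺ m

∈-litsOfElems⁻ : ∀ {L es} → L ∈ litsOfElems es → lit L ∈ es
∈-litsOfElems⁻ {es = lit _ ∷ es} (here refl) = here refl
∈-litsOfElems⁻ {es = lit _ ∷ es} (there m)   = there (∈-litsOfElems⁻ m)
∈-litsOfElems⁻ {es = top   ∷ es} m           = there (∈-litsOfElems⁻ m)
∈-litsOfElems⁻ {es = bot   ∷ es} m           = there (∈-litsOfElems⁻ m)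

programLits : Program ℕ → List (Lit ℕ)
programLits = concatMap litsOf

∈-programLits⁺ : ∀ {P r L} → r ∈ P → lit L ∈ elemsOf r → L ∈ programLits P
∈-programLits⁺ r∈P m = ∈-concatMap⁺ litsOf (lose r∈P (∈-litsOfElems⁺ m))

∈-programLits⁻ : ∀ {P L} → L ∈ programLits P → ∃ λ r → r ∈ P × lit L ∈ elemsOf r
∈-programLits⁻ {P} m with find (∈-concatMap⁻ litsOf {P} m)
... | r , r∈P , m′ = r , r∈P , ∈-litsOfElems⁻ m′

q1Rule rejRule q2Rule : BRule → Lit ℕ → Rule XAtom
q1Rule r L =
  rule (hlit (mapLit one L)) (map (mapElem orig) (pos r)) (lit (+ℓ (rej r)) ∷ map (mapElem orig) (neg r))
rejRule r L =
  rule (hlit (+ℓ (rej r))) (lit (compl (mapLit two L)) ∷ map (mapElem orig) (pos r))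
       (map (mapElem orig) (neg r))
q2Rule r L = rule (hlit (mapLit two L)) (map (mapElem orig) (pos r)) (map (mapElem orig) (neg r))

inh₁ inh₂ : Lit ℕ → Rule XAtom
inh₁ L = rule (hlit (mapLit one L)) (lit (mapLit two L) ∷ []) []
inh₂ L = rule (hlit (mapLit orig L)) (lit (mapLit one L) ∷ []) []

module Update (Q₁ Q₂ : Program ℕ) where

  private
    constraints q1Rules q2Rules : List (Rule XAtom)
    constraints = concatMap (λ r → constraintPart r (head r)) (Q₁ ++ Q₂)
    q1Rules     = concatMap (λ r → q1Part r (head r)) Q₁
    q2Rules     = concatMap (λ r → q2Part r (head r)) Q₂

    part-of : ∀ {X : Set} (f : X → List (Rule XAtom)) {xs x r} → x ∈ xs → r ∈ f x → r ∈ concatMap f xs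
    part-of f x∈ r∈ = ∈-concatMap⁺ f (lose x∈ r∈)

  constraint∈ : ∀ {r} → r ∈ Q₁ ++ Q₂ → head r ≡ hbot → embed r ∈ Q₁ ⊕₁ Q₂
  constraint∈ {r} m e =
    ∈-++⁺ˡ (part-of (λ r → constraintPart r (head r)) m
             (subst (λ h → embed r ∈ constraintPart r h) (sym e) (here refl)))

  q1Rule∈ : ∀ {r L} → r ∈ Q₁ → head r ≡ hlit L → q1Rule r L ∈ Q₁ ⊕₁ Q₂
  q1Rule∈ {r} {L} m e = ∈-++⁺ʳ constraints (∈-++⁺ˡ
    (part-of (λ r → q1Part r (head r)) m (subst (λ h → q1Rule r L ∈ q1Part r h) (sym e) (here refl))))

  rejRule∈ : ∀ {r L} → r ∈ Q₁ → head r ≡ hlit L → rejRule r L ∈ Q₁ ⊕₁ Q₂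
  rejRule∈ {r} {L} m e = ∈-++⁺ʳ constraints (∈-++⁺ˡ
    (part-of (λ r → q1Part r (head r)) m
       (subst (λ h → rejRule r L ∈ q1Part r h) (sym e) (there (here refl)))))

  q2Rule∈ : ∀ {r L} → r ∈ Q₂ → head r ≡ hlit L → q2Rule r L ∈ Q₁ ⊕₁ Q₂
  q2Rule∈ {r} {L} m e = ∈-++⁺ʳ constraints (∈-++⁺ʳ q1Rules (∈-++⁺ˡ
    (part-of (λ r → q2Part r (head r)) m (subst (λ h → q2Rule r L ∈ q2Part r h) (sym e) (here refl)))))

  inh₁∈ : ∀ {L} → L ∈ programLits (Q₁ ++ Q₂) → inh₁ L ∈ Q₁ ⊕₁ Q₂
  inh₁∈ m = ∈-++⁺ʳ constraints (∈-++⁺ʳ q1Rules (∈-++⁺ʳ q2Rules (part-of inhPart m (here refl))))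

  inh₂∈ : ∀ {L} → L ∈ programLits (Q₁ ++ Q₂) → inh₂ L ∈ Q₁ ⊕₁ Q₂
  inh₂∈ m = ∈-++⁺ʳ constraints (∈-++⁺ʳ q1Rules (∈-++⁺ʳ q2Rules (part-of inhPart m (there (here refl)))))

  data ⊕₁-Rule (r : Rule XAtom) : Set where
    constraint : ∀ r₀ → r₀ ∈ Q₁ ++ Q₂ → head r₀ ≡ hbot → r ≡ embed r₀ → ⊕₁-Rule r
    q1         : ∀ r₀ L → r₀ ∈ Q₁ → head r₀ ≡ hlit L → r ≡ q1Rule r₀ L → ⊕₁-Rule r
    rejection  : ∀ r₀ L → r₀ ∈ Q₁ → head r₀ ≡ hlit L → r ≡ rejRule r₀ L → ⊕₁-Rule r
    q2         : ∀ r₀ L → r₀ ∈ Q₂ → head r₀ ≡ hlit L → r ≡ q2Rule r₀ L → ⊕₁-Rule r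
    inherit₁   : ∀ L → L ∈ programLits (Q₁ ++ Q₂) → r ≡ inh₁ L → ⊕₁-Rule r
    inherit₂   : ∀ L → L ∈ programLits (Q₁ ++ Q₂) → r ≡ inh₂ L → ⊕₁-Rule r

  ⊕₁-rule⁻ : ∀ {r} → r ∈ Q₁ ⊕₁ Q₂ → ⊕₁-Rule r
  ⊕₁-rule⁻ {r} m with ∈-++⁻ constraints m
  ... | inj₁ m′ with find (∈-concatMap⁻ _ {Q₁ ++ Q₂} m′)
  ...   | r₀ , r₀∈ , m″ = fromConstraint (head r₀) refl m″
    where
    fromConstraint : ∀ h → head r₀ ≡ h → r ∈ constraintPart r₀ h → ⊕₁-Rule r
    fromConstraint hbot e (here refl) = constraint r₀ r₀∈ e refl
  ⊕₁-rule⁻ {r} m | inj₂ m′ with ∈-++⁻ q1Rules m′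
  ... | inj₁ m″ with find (∈-concatMap⁻ _ {Q₁} m″)
  ...   | r₀ , r₀∈ , m‴ = fromQ1 (head r₀) refl m‴
    where
    fromQ1 : ∀ h → head r₀ ≡ h → r ∈ q1Part r₀ h → ⊕₁-Rule r
    fromQ1 (hlit L) e (here refl)         = q1 r₀ L r₀∈ e refl
    fromQ1 (hlit L) e (there (here refl)) = rejection r₀ L r₀∈ e refl
  ⊕₁-rule⁻ {r} m | inj₂ m′ | inj₂ m″ with ∈-++⁻ q2Rules m″
  ... | inj₁ m‴ with find (∈-concatMap⁻ _ {Q₂} m‴)
  ...   | r₀ , r₀∈ , m⁗ = fromQ2 (head r₀) refl m⁗
    where
    fromQ2 : ∀ h → head r₀ ≡ h → r ∈ q2Part r₀ h → ⊕₁-Rule r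
    fromQ2 (hlit L) e (here refl) = q2 r₀ L r₀∈ e refl
  ⊕₁-rule⁻ {r} m | inj₂ m′ | inj₂ m″ | inj₂ m‴ with find (∈-concatMap⁻ inhPart {programLits (Q₁ ++ Q₂)} m‴)
  ... | L , L∈ , here refl         = inherit₁ L L∈ refl
  ... | L , L∈ , there (here refl) = inherit₂ L L∈ refl

  two-head⁻ : ∀ {r L} → r ∈ Q₁ ⊕₁ Q₂ → head r ≡ hlit (mapLit two L) →
              ∃ λ r₀ → r₀ ∈ Q₂ × head r₀ ≡ hlit L × r ≡ q2Rule r₀ L
  two-head⁻ m e with ⊕₁-rule⁻ m
  ... | constraint _ _ e₀ refl = contradiction (trans (sym (cong (mapHead orig) e₀)) e) λ ()
  ... | q1 _ _ _ _ refl        = contradiction (mapLit-atom {f = one} {two} (hlit-injective e)) λ ()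
  ... | rejection r₀ _ _ _ refl = contradiction (mapLit-atom {f = rej} {two} {+ℓ r₀} (hlit-injective e)) λ ()
  ... | inherit₁ _ _ refl      = contradiction (mapLit-atom {f = one} {two} (hlit-injective e)) λ ()
  ... | inherit₂ _ _ refl      = contradiction (mapLit-atom {f = orig} {two} (hlit-injective e)) λ ()
  ... | q2 r₀ _ r₀∈ e₀ refl with mapLit-injective (λ { refl → refl }) (hlit-injective e)
  ...   | refl = r₀ , r₀∈ , e₀ , refl

  one-head⁻ : ∀ {r L} → r ∈ Q₁ ⊕₁ Q₂ → head r ≡ hlit (mapLit one L) →
              (∃ λ r₀ → r₀ ∈ Q₁ × head r₀ ≡ hlit L) ⊎ (L ∈ programLits (Q₁ ++ Q₂) × r ≡ inh₁ L)
  one-head⁻ m e with ⊕₁-rule⁻ m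
  ... | constraint _ _ e₀ refl  = contradiction (trans (sym (cong (mapHead orig) e₀)) e) λ ()
  ... | rejection r₀ _ _ _ refl = contradiction (mapLit-atom {f = rej} {one} {+ℓ r₀} (hlit-injective e)) λ ()
  ... | q2 _ _ _ _ refl         = contradiction (mapLit-atom {f = two} {one} (hlit-injective e)) λ ()
  ... | inherit₂ _ _ refl       = contradiction (mapLit-atom {f = orig} {one} (hlit-injective e)) λ ()
  ... | q1 r₀ _ r₀∈ e₀ refl with mapLit-injective (λ { refl → refl }) (hlit-injective e)
  ...   | refl = inj₁ (r₀ , r₀∈ , e₀)
  one-head⁻ m e | inherit₁ _ L∈ refl with mapLit-injective (λ { refl → refl }) (hlit-injective e)
  ...   | refl = inj₂ (L∈ , refl)

  orig-head⁻ : ∀ {r L} → r ∈ Q₁ ⊕₁ Q₂ → head r ≡ hlit (mapLit orig L) →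
               L ∈ programLits (Q₁ ++ Q₂) × r ≡ inh₂ L
  orig-head⁻ m e with ⊕₁-rule⁻ m
  ... | constraint _ _ e₀ refl  = contradiction (trans (sym (cong (mapHead orig) e₀)) e) λ ()
  ... | q1 _ _ _ _ refl         = contradiction (mapLit-atom {f = one} {orig} (hlit-injective e)) λ ()
  ... | rejection r₀ _ _ _ refl = contradiction (mapLit-atom {f = rej} {orig} {+ℓ r₀} (hlit-injective e)) λ ()
  ... | q2 _ _ _ _ refl         = contradiction (mapLit-atom {f = two} {orig} (hlit-injective e)) λ ()
  ... | inherit₁ _ _ refl       = contradiction (mapLit-atom {f = one} {orig} (hlit-injective e)) λ ()
  ... | inherit₂ _ L∈ refl with mapLit-injective (λ { refl → refl }) (hlit-injective e)
  ...   | refl = L∈ , refl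

  UpdateAtom : XAtom → Set
  UpdateAtom (orig a) = AtomOccurs a (Q₁ ++ Q₂)
  UpdateAtom (one a)  = AtomOccurs a (Q₁ ++ Q₂)
  UpdateAtom (two a)  = AtomOccurs a (Q₁ ++ Q₂)
  UpdateAtom (rej r)  = r ∈ Q₁ × ∃ λ L → head r ≡ hlit L

  private
    copy-atom : ∀ {f : ℕ → XAtom} → (∀ a → AtomOccurs a (Q₁ ++ Q₂) → UpdateAtom (f a)) →
                ∀ {r L} → r ∈ Q₁ ++ Q₂ → lit L ∈ elemsOf r → UpdateAtom (atomOf (mapLit f L))
    copy-atom {f} tag {L = L} r∈ L∈ = subst UpdateAtom (sym (atomOf-mapLit f L)) (tag _ (atomOccurs r∈ L∈))

    body-atom : ∀ {r₀ l} → r₀ ∈ Q₁ ++ Q₂ → lit l ∈ pos (embed r₀) ++ neg (embed r₀) → UpdateAtom (atomOf l)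
    body-atom {r₀} r₀∈ m with embed-lit⁻ r₀ (there m)
    ... | L , L∈ , refl = copy-atom (λ _ o → o) r₀∈ L∈

    inherited-atom : ∀ {f : ℕ → XAtom} → (∀ a → AtomOccurs a (Q₁ ++ Q₂) → UpdateAtom (f a)) →
                     ∀ {L} → L ∈ programLits (Q₁ ++ Q₂) → UpdateAtom (atomOf (mapLit f L))
    inherited-atom {f} tag L∈ = let _ , r∈ , m = ∈-programLits⁻ {Q₁ ++ Q₂} L∈ in copy-atom {f} tag r∈ m

  ⊕₁-atom⁻ : ∀ {x} → AtomOccurs x (Q₁ ⊕₁ Q₂) → UpdateAtom x
  ⊕₁-atom⁻ (l , (r , r∈ , l∈) , refl) with ⊕₁-rule⁻ r∈
  ... | constraint r₀ r₀∈ _ refl with embed-lit⁻ r₀ l∈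
  ...   | L , L∈ , refl = copy-atom (λ _ o → o) r₀∈ L∈
  ⊕₁-atom⁻ (l , (r , r∈ , l∈) , refl) | q1 r₀ L r₀∈ e refl with l∈
  ... | here refl = copy-atom (λ _ o → o) (∈-++⁺ˡ r₀∈) (head∈elemsOf r₀ e)
  ... | there m with ∈-++⁻ (map (mapElem orig) (pos r₀)) m
  ...   | inj₁ m⁺         = body-atom (∈-++⁺ˡ r₀∈) (∈-++⁺ˡ m⁺)
  ...   | inj₂ (here refl) = r₀∈ , L , e
  ...   | inj₂ (there m⁻)  = body-atom (∈-++⁺ˡ r₀∈) (∈-++⁺ʳ (map (mapElem orig) (pos r₀)) m⁻)
  ⊕₁-atom⁻ (l , (r , r∈ , l∈) , refl) | rejection r₀ L r₀∈ e refl with l∈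
  ... | here refl         = r₀∈ , L , e
  ... | there (here refl) =
    subst UpdateAtom (sym (atomOf-compl (mapLit two L)))
          (copy-atom (λ _ o → o) (∈-++⁺ˡ r₀∈) (head∈elemsOf r₀ e))
  ... | there (there m)   = body-atom (∈-++⁺ˡ r₀∈) m
  ⊕₁-atom⁻ (l , (r , r∈ , l∈) , refl) | q2 r₀ L r₀∈ e refl with l∈
  ... | here refl = copy-atom (λ _ o → o) (∈-++⁺ʳ Q₁ r₀∈) (head∈elemsOf r₀ e)
  ... | there m   = body-atom (∈-++⁺ʳ Q₁ r₀∈) m
  ⊕₁-atom⁻ (l , (r , r∈ , l∈) , refl) | inherit₁ L L∈ refl with l∈
  ... | here refl         = inherited-atom (λ _ o → o) L∈
  ... | there (here refl) = inherited-atom (λ _ o → o) L∈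
  ⊕₁-atom⁻ (l , (r , r∈ , l∈) , refl) | inherit₂ L L∈ refl with l∈
  ... | here refl         = inherited-atom (λ _ o → o) L∈
  ... | there (here refl) = inherited-atom (λ _ o → o) L∈

  ⊕₁-atom⁺ : ∀ {x} → UpdateAtom x → AtomOccurs x (Q₁ ⊕₁ Q₂)
  ⊕₁-atom⁺ {orig a} (L , (r , r∈ , L∈) , refl) =
    mapLit orig L , (inh₂ L , inh₂∈ (∈-programLits⁺ r∈ L∈) , here refl) , atomOf-mapLit orig L
  ⊕₁-atom⁺ {one a}  (L , (r , r∈ , L∈) , refl) =
    mapLit one L , (inh₁ L , inh₁∈ (∈-programLits⁺ r∈ L∈) , here refl) , atomOf-mapLit one L
  ⊕₁-atom⁺ {two a}  (L , (r , r∈ , L∈) , refl) =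
    mapLit two L , (inh₁ L , inh₁∈ (∈-programLits⁺ r∈ L∈) , there (here refl)) , atomOf-mapLit two L
  ⊕₁-atom⁺ {rej r}  (r∈ , L , e) = +ℓ (rej r) , (rejRule r L , rejRule∈ r∈ e , here refl) , refl

-- Derivability in P₁ ⊕₁ P₂ of the rules of R

module Rename = Translation {ℕ} {XAtom} (atomᶠ ∘ orig) (∼ᶠ_ ∘ atomᶠ ∘ orig)

rename-ruleF : ∀ r → Rename.τ⁺ (ruleF r) ≡ ruleF (embed r)
rename-ruleF r =
  Rename.τ⁺-ruleF {m = mapElem orig} r (mapHead orig (head r)) (rename-head (head r)) (λ e _ → rename-elem e)
  where
  rename-head : ∀ h → Rename.τ⁺ (headF h) ≡ headF (mapHead orig h)
  rename-head (hlit (+ℓ a)) = refl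
  rename-head (hlit (-ℓ a)) = refl
  rename-head hbot          = refl
  rename-elem : ∀ e → Rename.τ⁺ (elemF e) ≡ elemF (mapElem orig e)
  rename-elem (lit (+ℓ a)) = refl
  rename-elem (lit (-ℓ a)) = refl
  rename-elem top          = refl
  rename-elem bot          = refl

module Derivable (P₁ P₂ R : Program ℕ) (tau-free : TauFree R) (P₂⊢R : P₂ ⊢Prog R) where

  open Update P₁ P₂
  open AnswerSetsℕ using (_≟ℓ_; atomLits; ∈-atomLits⁺)

  O : Program XAtom
  O = P₁ ⊕₁ P₂

  inherit : ∀ {Γ : Theory {XAtom}} → (∀ {ψ} → progT O ψ → Γ ψ) → ∀ {L} → L ∈ programLits (P₁ ++ P₂) →
            Γ ⊢ litF (mapLit two L) → Γ ⊢ litF (mapLit orig L)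
  inherit O⊆Γ {L} L∈ d =
    mp (hyp (O⊆Γ (inh₂ L , inh₂∈ L∈ , refl)))
       (∧I (mp (hyp (O⊆Γ (inh₁ L , inh₁∈ L∈ , refl))) (∧I d (ax ax⊤))) (ax ax⊤))

  embed-P₂ : ∀ {r} → r ∈ P₂ → progT O ⊢ ruleF (embed r)
  embed-P₂ {r} r∈ = derive (head r) refl
    where
    derive : ∀ h → head r ≡ h → progT O ⊢ ruleF (embed r)
    derive hbot     e = hyp (embed r , constraint∈ (∈-++⁺ʳ P₁ r∈) e , refl)
    derive (hlit L) e = subst (λ h → progT O ⊢ bodyF (embed r) ⇒ᶠ headF (mapHead orig h)) (sym e)
      (deduction (inherit inj₁ (∈-programLits⁺ (∈-++⁺ʳ P₁ r∈) (head∈elemsOf r e))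
                          (mp (wk (hyp (q2Rule r L , q2Rule∈ r∈ e , refl))) asm)))

  embed-derivation : ∀ {φ} → progT P₂ ⊢ φ → progT O ⊢ Rename.τ⁺ φ
  embed-derivation = Rename.translate (λ a → ax (axNat (orig a)))
    λ { (r , r∈ , refl) → subst (progT O ⊢_) (sym (rename-ruleF r)) (embed-P₂ r∈) }

  embed-R : ∀ {r} → r ∈ R → progT O ⊢ ruleF (embed r)
  embed-R {r} r∈ = subst (progT O ⊢_) (rename-ruleF r) (embed-derivation (P₂⊢R r r∈))

  Λ : List (Lit ℕ)
  Λ = atomLits (P₂ ++ R)

  ∈Λ : ∀ {r l} → r ∈ P₂ ++ R → lit l ∈ elemsOf r → l ∈ Λ
  ∈Λ r∈ l∈ = ∈-atomLits⁺ (atomOccurs r∈ l∈)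

  litO : Lit ℕ → Form XAtom
  litO l = litF (mapLit orig l)

  signed : Bool → Form XAtom → Form XAtom
  signed true  φ = ¬ᶠ ¬ᶠ φ
  signed false φ = ¬ᶠ φ

  -- A guess at the truth values of literals at T, assumed in the form ¬¬ l (true) or ¬ l (false).
  Assignment : Set
  Assignment = List (Lit ℕ × Bool)

  Assuming : Assignment → Theory {XAtom}
  Assuming asg φ = progT O φ ⊎ ∃ λ p → p ∈ asg × φ ≡ signed (proj₂ p) (litO (proj₁ p))

  valuation : Assignment → Lit ℕ → Bool
  valuation []              l = false
  valuation ((l′ , b) ∷ asg) l = if does (l ≟ℓ l′) then b else valuation asg l

  valuation-∈ : ∀ {asg l b} → (l , b) ∈ asg → (l , valuation asg l) ∈ asg
  valuation-∈ {(l′ , _) ∷ asg} {l} m with l ≟ℓ l′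
  ... | yes refl = here refl
  valuation-∈ (here refl) | no l≢l = contradiction refl l≢l
  valuation-∈ (there m)   | no _   = there (valuation-∈ m)

  valuation-true : ∀ {asg l} → valuation asg l ≡ true → (l , true) ∈ asg
  valuation-true {(l′ , b) ∷ asg} {l} e with l ≟ℓ l′
  valuation-true {(l′ , true) ∷ asg} e | yes refl = here refl
  ... | no _ = there (valuation-true e)

  Covers : List (Lit ℕ) → Assignment → Set
  Covers xs asg = ∀ l → l ∈ xs → ∃ λ b → (l , b) ∈ asg

  -- Weak excluded middle  ¬ l ∨ ¬¬ l  for each literal of xs.
  split-on : ∀ xs asg {φ} → (∀ asg′ → Covers xs asg′ → Assuming (asg′ ++ asg) ⊢ φ) → Assuming asg ⊢ φ
  split-on []       asg k = k [] (λ _ ())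
  split-on (l ∷ xs) asg {φ} k =
    ¬-or-¬¬ (⊢-mono (push false) (split-on xs ((l , false) ∷ asg) (k′ false)))
            (⊢-mono (push true)  (split-on xs ((l , true)  ∷ asg) (k′ true)))
    where
    push : ∀ b {ψ} → Assuming ((l , b) ∷ asg) ψ → (Assuming asg ,, signed b (litO l)) ψ
    push b (inj₁ h)                   = inj₁ (inj₁ h)
    push b (inj₂ (_ , here refl , e)) = inj₂ e
    push b (inj₂ (p , there m , e))   = inj₁ (inj₂ (p , m , e))
    k′ : ∀ b asg′ → Covers xs asg′ → Assuming (asg′ ++ (l , b) ∷ asg) ⊢ φ
    k′ b asg′ cov =
      subst (λ a → Assuming a ⊢ φ) (List.++-assoc asg′ [ (l , b) ] asg) (k (asg′ ++ [ (l , b) ]) cov′)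
      where
      cov′ : Covers (l ∷ xs) (asg′ ++ [ (l , b) ])
      cov′ _ (here refl) = b , ∈-++⁺ʳ asg′ (here refl)
      cov′ l′ (there m)  = let b′ , m′ = cov l′ m in b′ , ∈-++⁺ˡ m′

  ¬¬-clash : ∀ {Γ : Theory {XAtom}} l → Γ ⊢ ¬ᶠ ¬ᶠ litO l → Γ ⊢ ¬ᶠ ¬ᶠ litO (compl l) → Γ ⊢ ⊥ᶠ
  ¬¬-clash (+ℓ a) d d′ = ¬¬-coherent (orig a) d d′
  ¬¬-clash (-ℓ a) d d′ = ¬¬-coherent (orig a) d′ d

  module Branch (asg : Assignment) (cov : Covers Λ asg) where

    σ : Lit ℕ → Bool
    σ = valuation asg

    assumed-true : ∀ {l} → σ l ≡ true → Assuming asg ⊢ ¬ᶠ ¬ᶠ litO l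
    assumed-true {l} e = hyp (inj₂ ((l , true) , valuation-true e , refl))

    assumed-false : ∀ {l} → l ∈ Λ → σ l ≡ false → Assuming asg ⊢ ¬ᶠ litO l
    assumed-false {l} l∈Λ e =
      hyp (inj₂ ((l , σ l) , valuation-∈ (proj₂ (cov l l∈Λ)) , cong (λ b → signed b (litO l)) (sym e)))

    holdsᵇ : (Lit ℕ → Bool) → Elem ℕ → Bool
    holdsᵇ V (lit l) = V l
    holdsᵇ V top     = true
    holdsᵇ V bot     = false

    failsᵇ : Elem ℕ → Bool
    failsᵇ (lit l) = not (σ l)
    failsᵇ top     = false
    failsᵇ bot     = true

    -- The body of a rule of the reduct by σ, evaluated in V.
    bodyᵇ : (Lit ℕ → Bool) → BRule → Bool
    bodyᵇ V r = all (holdsᵇ V) (pos r) ∧ all failsᵇ (neg r)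

    satisfiesᵇ : Head ℕ → Bool
    satisfiesᵇ hbot     = false
    satisfiesᵇ (hlit l) = σ l

    coherentᵇ modelᵇ : Bool
    coherentᵇ = all (λ p → not (σ (proj₁ p) ∧ σ (compl (proj₁ p)))) asg
    modelᵇ    = all (λ r → bodyᵇ σ r ⇒ᵇ satisfiesᵇ (head r)) P₂

    bodyᵇ-mono : ∀ {V V′} r → (∀ l → V l ≡ true → V′ l ≡ true) → bodyᵇ V r ≡ true → bodyᵇ V′ r ≡ true
    bodyᵇ-mono {V} {V′} r V⊆V′ e with ∧-true⁻ {all (holdsᵇ V) (pos r)} e
    ... | ep , en =
      ∧-true⁺ (all-true⁺ (pos r) (All.map (λ {e} → mono e) (all-true⁻ (holdsᵇ V) (pos r) ep))) en
      where
      mono : ∀ e → holdsᵇ V e ≡ true → holdsᵇ V′ e ≡ true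
      mono (lit l) = V⊆V′ l
      mono top     = λ t → t

    bodyᵇ-eval : ∀ {hv} w r → eval hv σ w true (bodyF r) ≡ true → bodyᵇ (valueAt hv σ w) r ≡ true
    bodyᵇ-eval {hv} w r e with eval-body⁻ w r e
    ... | ep , en =
      ∧-true⁺ (all-true⁺ (pos r) (All.map (λ {e} → holds e) ep)) (all-true⁺ (neg r) (All.map (λ {e} → fails e) en))
      where
      holds : ∀ e → eval hv σ w true (elemF e) ≡ true → holdsᵇ (valueAt hv σ w) e ≡ true
      holds (lit l) t = trans (sym (eval-litF w l)) t
      holds top     _ = refl
      fails : ∀ e → eval hv σ w true (¬ᶠ elemF e) ≡ true → failsᵇ e ≡ true
      fails (lit l) t = cong not (trans (sym (eval-litF T l)) (eval-¬⁻ w (litF l) t))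
      fails top     t = contradiction (eval-¬⁻ {hv = hv} {σ} w ⊤ᶠ t) λ ()
      fails bot     _ = refl

    refute-incoherent : coherentᵇ ≡ false → Assuming asg ⊢ ⊥ᶠ
    refute-incoherent e with all-false⁻ asg e
    ... | (l , _) , _ , f = clash (σ l) (σ (compl l)) refl refl f
      where
      clash : ∀ a b → σ l ≡ a → σ (compl l) ≡ b → not (a ∧ b) ≡ false → Assuming asg ⊢ ⊥ᶠ
      clash true true e₁ e₂ _ = ¬¬-clash l (assumed-true e₁) (assumed-true e₂)

    refute-nonmodel : modelᵇ ≡ false → Assuming asg ⊢ ⊥ᶠ
    refute-nonmodel e with all-false⁻ P₂ e
    ... | r , r∈ , f with ⇒ᵇ-false⁻ {bodyᵇ σ r} f
    ...   | body-true , head-false = refute (head r) refl head-false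
      where
      r∈P₂R : r ∈ P₂ ++ R
      r∈P₂R = ∈-++⁺ˡ r∈
      ep : All (λ e → holdsᵇ σ e ≡ true) (pos r)
      ep = all-true⁻ (holdsᵇ σ) (pos r) (proj₁ (∧-true⁻ {all (holdsᵇ σ) (pos r)} body-true))
      en : All (λ e → failsᵇ e ≡ true) (neg r)
      en = all-true⁻ failsᵇ (neg r) (proj₂ (∧-true⁻ {all (holdsᵇ σ) (pos r)} body-true))
      ¬¬pos : ∀ {e} → holdsᵇ σ e ≡ true → Assuming asg ⊢ ¬ᶠ ¬ᶠ elemF (mapElem orig e)
      ¬¬pos {lit p} t = assumed-true t
      ¬¬pos {top}   _ = ¬¬-intro (ax ax⊤)
      ¬¬neg : ∀ {e} → e ∈ neg r → failsᵇ e ≡ true → Assuming asg ⊢ ¬ᶠ ¬ᶠ ¬ᶠ elemF (mapElem orig e)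
      ¬¬neg {lit q} m t = ¬¬-intro (assumed-false (∈Λ r∈P₂R (neg∈elemsOf r m)) (not-injective t))
      ¬¬neg {bot}   _ _ = ¬¬-intro ⊢-id
      ¬¬body : Assuming asg ⊢ ¬ᶠ ¬ᶠ bodyF (embed r)
      ¬¬body = ¬¬-body {r = embed r} (All.map⁺ (All.map (λ {e} → ¬¬pos {e}) ep))
                                     (All.map⁺ (All.tabulate λ m → ¬¬neg m (All.lookup en m)))
      rule-r : Assuming asg ⊢ ruleF (embed r)
      rule-r = ⊢-mono inj₁ (embed-P₂ r∈)
      rule-at : ∀ h → head r ≡ h → Assuming asg ⊢ bodyF (embed r) ⇒ᶠ headF (mapHead orig h)
      rule-at h e = subst (λ h → Assuming asg ⊢ bodyF (embed r) ⇒ᶠ headF (mapHead orig h)) e rule-r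
      refute : ∀ h → head r ≡ h → satisfiesᵇ h ≡ false → Assuming asg ⊢ ⊥ᶠ
      refute hbot     e _ = mp ¬¬body (rule-at hbot e)
      refute (hlit L) e f = mp ¬¬body (deduction (mp (wk (assumed-false (∈Λ r∈P₂R (head∈elemsOf r e)) f))
                                                     (mp (wk (rule-at (hlit L) e)) asm)))

    refute-body : ∀ {r} → r ∈ R → bodyᵇ σ r ≡ false → (Assuming asg ,, bodyF (embed r)) ⊢ ⊥ᶠ
    refute-body {r} r∈R e with ∧-false⁻ {all (holdsᵇ σ) (pos r)} e
    ... | inj₁ ep with all-false⁻ (pos r) ep
    ...   | lit p , m , f = mp (wk (assumed-false (∈Λ (∈-++⁺ʳ P₂ r∈R) (pos∈elemsOf r m)) f))
                               (⋀-elim asm (pos-conjunct {r = embed r} (∈-map⁺ (mapElem orig) m)))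
    ...   | bot   , m , _ = ⋀-elim asm (pos-conjunct {r = embed r} (∈-map⁺ (mapElem orig) m))
    refute-body {r} r∈R e | inj₂ en with all-false⁻ (neg r) en
    ...   | lit q , m , f = mp (wk (assumed-true (not-injective f)))
                               (⋀-elim asm (neg-conjunct {r = embed r} (∈-map⁺ (mapElem orig) m)))
    ...   | top   , m , _ = mp (⋀-elim asm (neg-conjunct {r = embed r} (∈-map⁺ (mapElem orig) m))) (ax ax⊤)

    -- The least model of the reduct of P₂ containing the positive body of r, computed by iteration.
    module Closure {r L} (r∈R : r ∈ R) (head≡L : head r ≡ hlit L)
                   (body-true : bodyᵇ σ r ≡ true) (model : modelᵇ ≡ true) (coherent : coherentᵇ ≡ true) where

      fires : (Lit ℕ → Bool) → Lit ℕ → Bool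
      fires V l = any (λ r′ → does (head r′ ≟ᴴ hlit l) ∧ bodyᵇ V r′) P₂

      closure : ℕ → Lit ℕ → Bool
      closure zero    l = does (any? (l ≟ℓ_) (litsOfElems (pos r)))
      closure (suc k) l = closure k l ∨ fires (closure k) l

      containsᵇ : (Lit ℕ → Bool) → Head ℕ → Bool
      containsᵇ V hbot     = true
      containsᵇ V (hlit l) = V l

      Closed : ℕ → Set
      Closed k = all (λ r′ → bodyᵇ (closure k) r′ ⇒ᵇ containsᵇ (closure k) (head r′)) P₂ ≡ true

      fires⁻ : ∀ V l → fires V l ≡ true → ∃ λ r′ → r′ ∈ P₂ × head r′ ≡ hlit l × bodyᵇ V r′ ≡ true
      fires⁻ V l e with any-true⁻ P₂ e
      ... | r′ , r′∈ , t with ∧-true⁻ {does (head r′ ≟ᴴ hlit l)} t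
      ...   | h , b = r′ , r′∈ , does-true⁻ (head r′ ≟ᴴ hlit l) h , b

      pos-true : All (λ e → holdsᵇ σ e ≡ true) (pos r)
      pos-true = all-true⁻ (holdsᵇ σ) (pos r) (proj₁ (∧-true⁻ {all (holdsᵇ σ) (pos r)} body-true))

      neg-true : All (λ e → failsᵇ e ≡ true) (neg r)
      neg-true = all-true⁻ failsᵇ (neg r) (proj₂ (∧-true⁻ {all (holdsᵇ σ) (pos r)} body-true))

      σ-model : ∀ {r′} → r′ ∈ P₂ → bodyᵇ σ r′ ≡ true → satisfiesᵇ (head r′) ≡ true
      σ-model r′∈ = ⇒ᵇ-elim (All.lookup (all-true⁻ _ P₂ model) r′∈)

      closure⊆σ : ∀ k l → closure k l ≡ true → σ l ≡ true
      closure⊆σ zero l e = All.lookup pos-true (∈-litsOfElems⁻ (does-true⁻ (any? (l ≟ℓ_) _) e))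
      closure⊆σ (suc k) l e with ∨-true⁻ {closure k l} e
      ... | inj₁ old = closure⊆σ k l old
      ... | inj₂ new with fires⁻ (closure k) l new
      ...   | r′ , r′∈ , h , b =
        subst (λ h → satisfiesᵇ h ≡ true) h (σ-model r′∈ (bodyᵇ-mono r′ (closure⊆σ k) b))

      pos⊆closure : ∀ k {l} → lit l ∈ pos r → closure k l ≡ true
      pos⊆closure zero    {l} m = Dec.dec-true (any? (l ≟ℓ_) (litsOfElems (pos r))) (∈-litsOfElems⁺ m)
      pos⊆closure (suc k)     m = ∨-trueˡ (pos⊆closure k m)

      closed-or-grows : ∀ k → Closed k ⊎ ∃ λ l → l ∈ Λ × closure k l ≡ false × closure (suc k) l ≡ true
      closed-or-grows k with all (λ r′ → bodyᵇ (closure k) r′ ⇒ᵇ containsᵇ (closure k) (head r′)) P₂ in c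
      ... | true  = inj₁ refl
      ... | false with all-false⁻ P₂ c
      ...   | r′ , r′∈ , f with ⇒ᵇ-false⁻ {bodyᵇ (closure k) r′} f
      ...     | b , h = inj₂ (new (head r′) refl h)
        where
        new : ∀ h → head r′ ≡ h → containsᵇ (closure k) h ≡ false →
              ∃ λ l → l ∈ Λ × closure k l ≡ false × closure (suc k) l ≡ true
        new (hlit l) e f′ = l , ∈Λ (∈-++⁺ˡ r′∈) (head∈elemsOf r′ e) , f′ ,
          ∨-trueʳ {closure k l} (any-true⁺ r′∈ (∧-true⁺ (Dec.dec-true (head r′ ≟ᴴ hlit l) e) b))

      closed-stays : ∀ k → Closed k → Closed (suc k)
      closed-stays k c = all-true⁺ P₂ (All.tabulate λ r′∈ → ⇒ᵇ-intro (keep r′∈))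
        where
        closed-at : ∀ {r′} → r′ ∈ P₂ → bodyᵇ (closure k) r′ ≡ true → containsᵇ (closure k) (head r′) ≡ true
        closed-at r′∈ = ⇒ᵇ-elim (All.lookup (all-true⁻ _ P₂ c) r′∈)
        back : ∀ l → closure (suc k) l ≡ true → closure k l ≡ true
        back l e with ∨-true⁻ {closure k l} e
        ... | inj₁ old = old
        ... | inj₂ new with fires⁻ (closure k) l new
        ...   | r′ , r′∈ , h , b = subst (λ h → containsᵇ (closure k) h ≡ true) h (closed-at r′∈ b)
        keep : ∀ {r′} → r′ ∈ P₂ → bodyᵇ (closure (suc k)) r′ ≡ true →
               containsᵇ (closure (suc k)) (head r′) ≡ true
        keep {r′} r′∈ b with head r′ | closed-at r′∈ (bodyᵇ-mono r′ back b)
        ... | hbot   | _ = refl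
        ... | hlit l | t = ∨-trueˡ t

      bound : ℕ
      bound = suc (length Λ)

      D : Lit ℕ → Bool
      D = closure bound

      D-closed : Closed bound
      D-closed = chain-closes Λ closure Closed (λ k l → ∨-trueˡ) closed-stays closed-or-grows

      D⊆σ : Persistent D σ
      D⊆σ = closure⊆σ bound

      σ-coherent : Coherent σ
      σ-coherent a with σ (+ℓ a) in e
      ... | false = refl
      ... | true  = not-injective (subst (λ b → not (b ∧ σ (-ℓ a)) ≡ true) e
                                         (All.lookup (all-true⁻ _ asg coherent) (valuation-true e)))

      P₂-holds : ∀ {ψ} → progT P₂ ψ → eval D σ H true ψ ≡ true
      P₂-holds (r′ , r′∈ , refl) = ∧-true⁺ (⇒ᵇ-intro at-H) (⇒ᵇ-intro at-T)
        where
        head-at-T : ∀ h → satisfiesᵇ h ≡ true → eval D σ T true (headF h) ≡ true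
        head-at-T (hlit l) t = trans (eval-litF T l) t
        at-T : eval D σ T true (bodyF r′) ≡ true → eval D σ T true (headF (head r′)) ≡ true
        at-T b = head-at-T (head r′) (σ-model r′∈ (bodyᵇ-eval T r′ b))
        at-H : eval D σ H true (bodyF r′) ≡ true → eval D σ H true (headF (head r′)) ≡ true
        at-H b with head r′ | σ-model r′∈ (bodyᵇ-eval T r′ (eval-persistent D⊆σ true (bodyF r′) b))
                            | ⇒ᵇ-elim (All.lookup (all-true⁻ _ P₂ D-closed) r′∈) (bodyᵇ-eval H r′ b)
        ... | hlit l | _ | t = trans (eval-litF H l) t

      body-holds : eval D σ H true (bodyF r) ≡ true
      body-holds = eval-body⁺ H r (All.tabulate λ m → pos-holds m (All.lookup pos-true m))
                                  (All.map (λ {e} → neg-holds {e}) neg-true)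
        where
        pos-holds : ∀ {e} → e ∈ pos r → holdsᵇ σ e ≡ true → eval D σ H true (elemF e) ≡ true
        pos-holds {lit p} m _ = trans (eval-litF H p) (pos⊆closure bound m)
        pos-holds {top}   _ _ = refl
        neg-holds : ∀ {e} → failsᵇ e ≡ true → eval D σ H true (¬ᶠ elemF e) ≡ true
        neg-holds {lit q} t = eval-¬ D⊆σ H (litF q) (trans (eval-litF T q) (not-injective t))
        neg-holds {bot}   _ = refl

      L∈D : D L ≡ true
      L∈D = trans (sym (eval-litF H L)) (subst (λ h → eval D σ H true (headF h) ≡ true) head≡L
              (⇒ᵇ-elim (proj₁ (∧-true⁻ {eval D σ H true (bodyF r) ⇒ᵇ eval D σ H true (headF (head r))}
                                 (soundness D⊆σ σ-coherent P₂-holds (P₂⊢R r r∈R) H)))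
                       body-holds))

      Γ′ : Theory {XAtom}
      Γ′ = Assuming asg ,, bodyF (embed r)

      closure-source : ∀ k l → closure k l ≡ true →
                       lit l ∈ pos r ⊎ (l ∈ programLits (P₁ ++ P₂) × (Γ′ ⊢ litF (mapLit two l)))
      closure-derivable : ∀ k l → closure k l ≡ true → Γ′ ⊢ litO l

      closure-source zero    l e = inj₁ (∈-litsOfElems⁻ (does-true⁻ (any? (l ≟ℓ_) _) e))
      closure-source (suc k) l e with ∨-true⁻ {closure k l} e
      ... | inj₁ old = closure-source k l old
      ... | inj₂ new with fires⁻ (closure k) l new
      ...   | r′ , r′∈ , h , b =
        inj₂ (∈-programLits⁺ (∈-++⁺ʳ P₁ r′∈) (head∈elemsOf r′ h) ,
              mp (wk (hyp (inj₁ (q2Rule r′ l , q2Rule∈ r′∈ h , refl)))) body′)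
        where
        bp : All (λ e → holdsᵇ (closure k) e ≡ true) (pos r′)
        bp = all-true⁻ (holdsᵇ (closure k)) (pos r′) (proj₁ (∧-true⁻ {all (holdsᵇ (closure k)) (pos r′)} b))
        bn : All (λ e → failsᵇ e ≡ true) (neg r′)
        bn = all-true⁻ failsᵇ (neg r′) (proj₂ (∧-true⁻ {all (holdsᵇ (closure k)) (pos r′)} b))
        pos′ : ∀ {e} → holdsᵇ (closure k) e ≡ true → Γ′ ⊢ elemF (mapElem orig e)
        pos′ {lit p} t = closure-derivable k p t
        pos′ {top}   _ = ax ax⊤
        neg′ : ∀ {e} → e ∈ neg r′ → failsᵇ e ≡ true → Γ′ ⊢ ¬ᶠ elemF (mapElem orig e)
        neg′ {lit q} m t = wk (assumed-false (∈Λ (∈-++⁺ˡ r′∈) (neg∈elemsOf r′ m)) (not-injective t))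
        neg′ {bot}   _ _ = ⊢-id
        body′ : Γ′ ⊢ bodyF (embed r′)
        body′ = ⊢-body {r = embed r′} (All.map⁺ (All.map (λ {e} → pos′ {e}) bp))
                                      (All.map⁺ (All.tabulate λ m → neg′ m (All.lookup bn m)))

      closure-derivable k l e with closure-source k l e
      ... | inj₁ m        = ⋀-elim asm (pos-conjunct {r = embed r} (∈-map⁺ (mapElem orig) m))
      ... | inj₂ (l∈ , d) = inherit (inj₁ ∘ inj₁) l∈ d

      L₂-derivable : Γ′ ⊢ litF (mapLit two L)
      L₂-derivable with closure-source bound L L∈D
      ... | inj₁ m       = ⊥-elim (tau-free r L r∈R head≡L m)
      ... | inj₂ (_ , d) = d

    branch : ∀ {r L} → r ∈ R → head r ≡ hlit L → Assuming asg ⊢ bodyF (embed r) ⇒ᶠ litF (mapLit two L)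
    branch {r} r∈R head≡L with coherentᵇ in coherent | modelᵇ in model | bodyᵇ σ r in body
    ... | false | _     | _     = ⊥E (refute-incoherent coherent)
    ... | true  | false | _     = ⊥E (refute-nonmodel model)
    ... | true  | true  | false = deduction (⊥E (refute-body r∈R body))
    ... | true  | true  | true  = deduction (Closure.L₂-derivable r∈R head≡L body model coherent)

  two-derivable : ∀ {r L} → r ∈ R → head r ≡ hlit L → progT O ⊢ bodyF (embed r) ⇒ᶠ litF (mapLit two L)
  two-derivable r∈R head≡L = ⊢-mono unassumed (split-on Λ [] λ asg cov →
    subst (λ a → Assuming a ⊢ _) (sym (List.++-identityʳ asg)) (Branch.branch asg cov r∈R head≡L))
    where
    unassumed : ∀ {ψ} → Assuming [] ψ → progT O ψ
    unassumed (inj₁ h) = h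

-- Comparing P₁ ⊕₁ P₂ with P₁ ⊕₁ (P₂ ∪ R)

module Comparison (P₁ P₂ R : Program ℕ) (tau-free : TauFree R) (P₂⊢R : P₂ ⊢Prog R) where

  open Derivable P₁ P₂ R tau-free P₂⊢R using (O; embed-R; two-derivable)
  open AnswerSetsℕ using (_≟ℓ_)
  module O = Update P₁ P₂
  module N = Update P₁ (P₂ ++ R)

  N : Program XAtom
  N = P₁ ⊕₁ (P₂ ++ R)

  Fresh : Lit ℕ → Set
  Fresh L = ¬ L ∈ programLits (P₁ ++ P₂)

  ++-mono : ∀ {r} → r ∈ P₁ ++ P₂ → r ∈ P₁ ++ (P₂ ++ R)
  ++-mono m = subst (_ ∈_) (List.++-assoc P₁ P₂ R) (∈-++⁺ˡ m)

  programLits-mono : ∀ {L} → L ∈ programLits (P₁ ++ P₂) → L ∈ programLits (P₁ ++ (P₂ ++ R))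
  programLits-mono m = let r , r∈ , L∈ = ∈-programLits⁻ {P₁ ++ P₂} m in ∈-programLits⁺ (++-mono r∈) L∈

  O⊆N : ∀ {r} → r ∈ O → r ∈ N
  O⊆N m with O.⊕₁-rule⁻ m
  ... | O.constraint r₀ r₀∈ e refl = N.constraint∈ (++-mono r₀∈) e
  ... | O.q1 r₀ L r₀∈ e refl        = N.q1Rule∈ r₀∈ e
  ... | O.rejection r₀ L r₀∈ e refl = N.rejRule∈ r₀∈ e
  ... | O.q2 r₀ L r₀∈ e refl        = N.q2Rule∈ (∈-++⁺ˡ r₀∈) e
  ... | O.inherit₁ L L∈ refl        = N.inh₁∈ (programLits-mono L∈)
  ... | O.inherit₂ L L∈ refl        = N.inh₂∈ (programLits-mono L∈)

  data NewRule (r : Rule XAtom) : Set where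
    R-constraint : ∀ r₀ → r₀ ∈ R → head r₀ ≡ hbot → r ≡ embed r₀ → NewRule r
    R-q2         : ∀ r₀ L → r₀ ∈ R → head r₀ ≡ hlit L → r ≡ q2Rule r₀ L → NewRule r
    fresh-inh₁   : ∀ L → Fresh L → r ≡ inh₁ L → NewRule r
    fresh-inh₂   : ∀ L → Fresh L → r ≡ inh₂ L → NewRule r

  N-rule⁻ : ∀ {r} → r ∈ N → r ∈ O ⊎ NewRule r
  N-rule⁻ m with N.⊕₁-rule⁻ m
  ... | N.constraint r₀ r₀∈ e refl with ∈-++⁻ P₁ r₀∈
  ...   | inj₁ r₀∈P₁ = inj₁ (O.constraint∈ (∈-++⁺ˡ r₀∈P₁) e)
  ...   | inj₂ r₀∈P₂R with ∈-++⁻ P₂ r₀∈P₂R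
  ...     | inj₁ r₀∈P₂ = inj₁ (O.constraint∈ (∈-++⁺ʳ P₁ r₀∈P₂) e)
  ...     | inj₂ r₀∈R  = inj₂ (R-constraint r₀ r₀∈R e refl)
  N-rule⁻ m | N.q1 r₀ L r₀∈ e refl        = inj₁ (O.q1Rule∈ r₀∈ e)
  N-rule⁻ m | N.rejection r₀ L r₀∈ e refl = inj₁ (O.rejRule∈ r₀∈ e)
  N-rule⁻ m | N.q2 r₀ L r₀∈ e refl with ∈-++⁻ P₂ r₀∈
  ...   | inj₁ r₀∈P₂ = inj₁ (O.q2Rule∈ r₀∈P₂ e)
  ...   | inj₂ r₀∈R  = inj₂ (R-q2 r₀ L r₀∈R e refl)
  N-rule⁻ m | N.inherit₁ L _ refl with any? (L ≟ℓ_) (programLits (P₁ ++ P₂))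
  ...   | yes L∈ = inj₁ (O.inh₁∈ L∈)
  ...   | no  L∉ = inj₂ (fresh-inh₁ L L∉ refl)
  N-rule⁻ m | N.inherit₂ L _ refl with any? (L ≟ℓ_) (programLits (P₁ ++ P₂))
  ...   | yes L∈ = inj₁ (O.inh₂∈ L∈)
  ...   | no  L∉ = inj₂ (fresh-inh₂ L L∉ refl)

  occursᵇ : XAtom → Bool
  occursᵇ x = does (AnswerSetsˣ.atomOccurs? x O)

  module Erase = Translation (λ x → if occursᵇ x then atomᶠ x else ⊥ᶠ)
                             (λ x → if occursᵇ x then ∼ᶠ atomᶠ x else ⊥ᶠ)

  erase-nelson : ∀ {Γ : Theory {XAtom}} x →
    Γ ⊢ (if occursᵇ x then ∼ᶠ atomᶠ x else ⊥ᶠ) ⇒ᶠ ¬ᶠ (if occursᵇ x then atomᶠ x else ⊥ᶠ)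
  erase-nelson x with occursᵇ x
  ... | true  = ax (axNat x)
  ... | false = ax (ax⊥E _)

  erase-occurring : ∀ {l} → AtomOccurs (atomOf l) O → Erase.τ⁺ (litF l) ≡ litF l
  erase-occurring {+ℓ x} o rewrite Dec.dec-true (AnswerSetsˣ.atomOccurs? x O) o = refl
  erase-occurring { -ℓ x} o rewrite Dec.dec-true (AnswerSetsˣ.atomOccurs? x O) o = refl

  erase-absent : ∀ {l} → ¬ AtomOccurs (atomOf l) O → Erase.τ⁺ (litF l) ≡ ⊥ᶠ
  erase-absent {+ℓ x} ¬o rewrite Dec.dec-false (AnswerSetsˣ.atomOccurs? x O) ¬o = refl
  erase-absent { -ℓ x} ¬o rewrite Dec.dec-false (AnswerSetsˣ.atomOccurs? x O) ¬o = refl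

  erase-O-rule : ∀ {r} → r ∈ O → Erase.τ⁺ (ruleF r) ≡ ruleF r
  erase-O-rule {r} m =
    trans (Erase.τ⁺-ruleF {m = λ e → e} r (head r) (erase-head (head r) refl) erase-elem)
          (cong₂ (λ p n → ruleF (rule (head r) p n)) (List.map-id (pos r)) (List.map-id (neg r)))
    where
    erase-head : ∀ h → head r ≡ h → Erase.τ⁺ (headF h) ≡ headF h
    erase-head hbot     _ = refl
    erase-head (hlit L) e = erase-occurring (atomOccurs m (head∈elemsOf r e))
    erase-elem : ∀ e → e ∈ pos r ++ neg r → Erase.τ⁺ (elemF e) ≡ elemF e
    erase-elem (lit l) i = erase-occurring (atomOccurs m (there i))
    erase-elem top     _ = refl
    erase-elem bot     _ = refl

  erase-O : ∀ {φ} → progT O ⊢ φ → progT O ⊢ Erase.τ⁺ φ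
  erase-O = Erase.translate erase-nelson
    λ { (r , m , refl) → subst (progT O ⊢_) (sym (erase-O-rule m)) (hyp (r , m , refl)) }

  no-head-two : ∀ {L r} → Fresh L → r ∈ O → head r ≢ hlit (mapLit two L)
  no-head-two fresh m e =
    let r₀ , r₀∈ , e₀ , _ = O.two-head⁻ m e in fresh (∈-programLits⁺ (∈-++⁺ʳ P₁ r₀∈) (head∈elemsOf r₀ e₀))

  no-head-one : ∀ {L r} → Fresh L → r ∈ O → head r ≢ hlit (mapLit one L)
  no-head-one fresh m e with O.one-head⁻ m e
  ... | inj₁ (r₀ , r₀∈ , e₀) = fresh (∈-programLits⁺ (∈-++⁺ˡ r₀∈) (head∈elemsOf r₀ e₀))
  ... | inj₂ (L∈ , _)        = fresh L∈

  fresh-absent-O : ∀ {S} → AnswerSet O S → ∀ {L} → Fresh L → ¬ S (mapLit two L) × ¬ S (mapLit one L)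
  fresh-absent-O as fresh = (λ s → AnswerSetsˣ.answerSet-supported as s λ m e _ → no-head-two fresh m e)
                          , (λ s → AnswerSetsˣ.answerSet-supported as s λ m e _ → no-head-one fresh m e)

  -- In N, L₂ can only be supported by a rule of R, which O derives without any rule for L₂.
  fresh-absent-N : ∀ {S} → AnswerSet N S → ∀ {L} → Fresh L →
                   ¬ S (mapLit two L) × ¬ S (mapLit one L) × ¬ S (mapLit orig L)
  fresh-absent-N {S} as {L} fresh = ¬two , ¬one , ¬orig
    where
    ¬two : ¬ S (mapLit two L)
    ¬two s = AnswerSetsˣ.answerSet-supported as s unsupported
      where
      unsupported : ∀ {r} → r ∈ N → head r ≡ hlit (mapLit two L) → ¬ BodyTrue S r
      unsupported m e bt with N.two-head⁻ m e
      ... | r₀ , r₀∈ , e₀ , refl with ∈-++⁻ P₂ r₀∈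
      ...   | inj₁ r₀∈P₂ = fresh (∈-programLits⁺ (∈-++⁺ʳ P₁ r₀∈P₂) (head∈elemsOf r₀ e₀))
      ...   | inj₂ r₀∈R  = AnswerSetsˣ.answerSet-needs-head as s O O⊆N (no-head-two fresh) (q2Rule r₀ L)
                             (two-derivable r₀∈R e₀) bt orig≢two
        where
        orig≢two : ∀ {l} → lit l ∈ pos (q2Rule r₀ L) → l ≢ mapLit two L
        orig≢two m e′ with embed-lit⁻ r₀ (there (∈-++⁺ˡ m))
        ... | _ , _ , refl = contradiction (mapLit-atom {f = orig} {two} e′) λ ()
    ¬one : ¬ S (mapLit one L)
    ¬one s = AnswerSetsˣ.answerSet-supported as s unsupported
      where
      unsupported : ∀ {r} → r ∈ N → head r ≡ hlit (mapLit one L) → ¬ BodyTrue S r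
      unsupported m e bt with N.one-head⁻ m e
      ... | inj₁ (r₀ , r₀∈ , e₀) = fresh (∈-programLits⁺ (∈-++⁺ˡ r₀∈) (head∈elemsOf r₀ e₀))
      ... | inj₂ (_ , refl)      = ¬two (All.lookup (proj₁ bt) (here refl))
    ¬orig : ¬ S (mapLit orig L)
    ¬orig s = AnswerSetsˣ.answerSet-supported as s unsupported
      where
      unsupported : ∀ {r} → r ∈ N → head r ≡ hlit (mapLit orig L) → ¬ BodyTrue S r
      unsupported m e bt with N.orig-head⁻ m e
      ... | _ , refl = ¬one (All.lookup (proj₁ bt) (here refl))

  module Transfer (S : Lit XAtom → Set) (S⊆O : ∀ l → S l → AtomOccurs (atomOf l) O)
                  (absent : ∀ {L} → Fresh L → ¬ S (mapLit two L) × ¬ S (mapLit one L)) where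

    ¬erased : ∀ {x} → ¬ S x → answerTheory O S ⊢ ¬ᶠ Erase.τ⁺ (litF x)
    ¬erased {x} ¬s with AnswerSetsˣ.atomOccurs? (atomOf x) O
    ... | yes o rewrite erase-occurring {x} o = ⊢-¬lit o ¬s
    ... | no ¬o rewrite erase-absent {x} ¬o   = ⊢-id

    erase-hyp : ∀ {ψ} → answerTheory N S ψ → answerTheory O S ⊢ Erase.τ⁺ ψ
    erase-hyp (inj₁ (r , m , refl)) with N-rule⁻ m
    ... | inj₁ r∈O = subst (answerTheory O S ⊢_) (sym (erase-O-rule r∈O)) (⊢-rule {S = S} r∈O)
    ... | inj₂ (R-constraint r₀ r₀∈R _ refl) = ⊢-mono inj₁ (erase-O (embed-R r₀∈R))
    ... | inj₂ (R-q2 r₀ L r₀∈R e refl)       = ⊢-mono inj₁ (erase-O (two-derivable r₀∈R e))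
    ... | inj₂ (fresh-inh₁ L fresh refl) = deduction (⊥E (mp (wk (¬erased (proj₁ (absent fresh)))) (∧E₁ asm)))
    ... | inj₂ (fresh-inh₂ L fresh refl) = deduction (⊥E (mp (wk (¬erased (proj₂ (absent fresh)))) (∧E₁ asm)))
    erase-hyp (inj₂ (inj₁ (l , _ , ¬s , refl))) = ¬erased ¬s
    erase-hyp (inj₂ (inj₂ (l , s , refl))) rewrite erase-occurring {l} (S⊆O l s) =
      hyp (inj₂ (inj₂ (l , s , refl)))

    transfer : ∀ {φ} → answerTheory N S ⊢ φ → answerTheory O S ⊢ Erase.τ⁺ φ
    transfer = Erase.translate erase-nelson erase-hyp

  unless-fresh : ∀ {X : Set} L → ¬ Fresh L → (AtomOccurs (atomOf L) (P₁ ++ P₂) → X) → X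
  unless-fresh L not-fresh k with AnswerSetsℕ.atomOccurs? (atomOf L) (P₁ ++ P₂)
  ... | yes o = k o
  ... | no ¬o = ⊥-elim (not-fresh λ L∈ →
                  ¬o (let _ , r∈ , m = ∈-programLits⁻ {P₁ ++ P₂} L∈ in atomOccurs r∈ m))

  N-answer-in-O : ∀ {S} → AnswerSet N S → ∀ l → S l → AtomOccurs (atomOf l) O
  N-answer-in-O {S} as l s = in-O l s (N.⊕₁-atom⁻ (AnswerSetFields.occurs as l s))
    where
    absent : ∀ {L} → Fresh L → ¬ S (mapLit two L) × ¬ S (mapLit one L) × ¬ S (mapLit orig L)
    absent = fresh-absent-N as
    in-O : ∀ l → S l → N.UpdateAtom (atomOf l) → AtomOccurs (atomOf l) O
    in-O (+ℓ (orig a)) s _ = unless-fresh (+ℓ a) (λ fr → proj₂ (proj₂ (absent fr)) s) (O.⊕₁-atom⁺ {orig a})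
    in-O (-ℓ (orig a)) s _ = unless-fresh (-ℓ a) (λ fr → proj₂ (proj₂ (absent fr)) s) (O.⊕₁-atom⁺ {orig a})
    in-O (+ℓ (one a))  s _ = unless-fresh (+ℓ a) (λ fr → proj₁ (proj₂ (absent fr)) s) (O.⊕₁-atom⁺ {one a})
    in-O (-ℓ (one a))  s _ = unless-fresh (-ℓ a) (λ fr → proj₁ (proj₂ (absent fr)) s) (O.⊕₁-atom⁺ {one a})
    in-O (+ℓ (two a))  s _ = unless-fresh (+ℓ a) (λ fr → proj₁ (absent fr) s) (O.⊕₁-atom⁺ {two a})
    in-O (-ℓ (two a))  s _ = unless-fresh (-ℓ a) (λ fr → proj₁ (absent fr) s) (O.⊕₁-atom⁺ {two a})
    in-O (+ℓ (rej r))  _ u = O.⊕₁-atom⁺ {rej r} u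
    in-O (-ℓ (rej r))  _ u = O.⊕₁-atom⁺ {rej r} u

  orig-occurs : ∀ {S : Lit XAtom → Set} → (∀ l → S l → AtomOccurs (atomOf l) O) →
                ∀ l → S (mapLit orig l) → AtomOccurs (atomOf l) (P₁ ++ P₂)
  orig-occurs S⊆O l s =
    O.⊕₁-atom⁻ {orig (atomOf l)} (subst (λ x → AtomOccurs x O) (atomOf-mapLit orig l) (S⊆O (mapLit orig l) s))

  forward : ∀ M → UpdateAnswerSet P₁ P₂ M → UpdateAnswerSet P₁ (P₂ ++ R) M
  forward M (S , as , M≈S) = S , as′ , M≈S′
    where
    open AnswerSetFields as
    open Transfer S occurs (fresh-absent-O as)
    as′ : AnswerSet N S
    as′ = (λ l s → AtomOccurs-mono O⊆N (occurs l s)) , consistent , N2-consistency ∘ transfer ,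
          λ l s → ⊢-mono (answerTheory-mono O⊆N) (derives l s)
    M≈S′ : ∀ l → (M l → S (mapLit orig l) × AtomOccurs (atomOf l) (P₁ ++ (P₂ ++ R)))
               × (S (mapLit orig l) × AtomOccurs (atomOf l) (P₁ ++ (P₂ ++ R)) → M l)
    M≈S′ l = (λ m → let s , o = proj₁ (M≈S l) m in s , AtomOccurs-mono ++-mono o)
           , (λ (s , _) → proj₂ (M≈S l) (s , orig-occurs occurs l s))

  backward : ∀ M → UpdateAnswerSet P₁ (P₂ ++ R) M → UpdateAnswerSet P₁ P₂ M
  backward M (S , as , M≈S) = S , as′ , M≈S′
    where
    open AnswerSetFields as
    S⊆O : ∀ l → S l → AtomOccurs (atomOf l) O
    S⊆O = N-answer-in-O as
    open Transfer S S⊆O (λ fresh → proj₁ (fresh-absent-N as fresh) , proj₁ (proj₂ (fresh-absent-N as fresh)))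
    as′ : AnswerSet O S
    as′ = S⊆O , consistent , N2-consistency ∘ ⊢-mono (answerTheory-mono O⊆N) ,
          λ l s → subst (answerTheory O S ⊢_) (erase-occurring (S⊆O l s)) (transfer (derives l s))
    M≈S′ : ∀ l → (M l → S (mapLit orig l) × AtomOccurs (atomOf l) (P₁ ++ P₂))
               × (S (mapLit orig l) × AtomOccurs (atomOf l) (P₁ ++ P₂) → M l)
    M≈S′ l = (λ m → let s , _ = proj₁ (M≈S l) m in s , orig-occurs S⊆O l s)
           , (λ (s , o) → proj₂ (M≈S l) (s , AtomOccurs-mono ++-mono o))

lemmaA9 : (P₁ P₂ R : Program ℕ) → TauFree R → P₂ ⊢Prog R →
    (M : Lit ℕ → Set) →
    (UpdateAnswerSet P₁ P₂ M → UpdateAnswerSet P₁ (P₂ ++ R) M)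
    × (UpdateAnswerSet P₁ (P₂ ++ R) M → UpdateAnswerSet P₁ P₂ M)
lemmaA9 P₁ P₂ R tau-free P₂⊢R M = forward M , backward M
  where open Comparison P₁ P₂ R tau-free P₂⊢R
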